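{- Let $p\ge 2$. For $n,k\ge0$ let $b_{n,k}$ be the number of boolean intervals of height $k$ in $\mathbb{F}_n^p$. Then $$\sum_{n,k\ge0}b_{n,k}x^ny^k=\frac{(1-x)(1+yx^p)}{1-2x+x^{p+1}-y\bigl(x^2-x^p+x^{p+1}-x^{p+2}\bigr)}.$$
   Context: A Dyck path of semilength $n\ge 0$ is a lattice path from $(0,0)$ to $(2n,0)$ with steps $U=(1,1)$ and $D=(1,-1)$ that never goes below the $x$-axis; it is identified with its word over $\{U,D\}$. A path avoids a pattern $\alpha$ if $\alpha$ does not occur as a factor (block of consecutive steps). For an integer $p\ge 2$, $\mathcal{F}_n^p$ is the set of Dyck paths of semilength $n$ avoiding $DUU$ and $D^{p+1}$, ordered by the Stanley order: $P\le Q$ iff $P$ lies weakly below $Q$ when both are drawn in the plane; $\mathbb{F}_n^p=(\mathcal{F}_n^p,\le)$. An interval is a set $[P,Q]=\{R: P\le R\le Q\}$ for $P\le Q$ (including $P=Q$); its height is the length of a maximal chain from $P$ to $Q$. An interval is boolean if it is isomorphic as a poset to the lattice of subsets of a finite set. -}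

module Defs where

open import Data.Nat using (ℕ; zero; suc; _*_; _∸_; _≡ᵇ_)
open import Data.Integer as ℤ using (ℤ; +_; -_)
open import Data.Bool using (Bool; true; false; _∧_; if_then_else_)
open import Data.List using (List; []; _∷_; _++_; length; replicate; take)
open import Data.List.Relation.Unary.Unique.Propositional using (Unique)
open import Data.List.Membership.Propositional using (_∈_)
open import Data.Product using (Σ; ∃; ∃-syntax; _×_; _,_)
open import Data.Empty using (⊥)
open import Data.Unit using (⊤)
open import Data.Sum using (_⊎_)
open import Data.Fin.Subset using (Subset; _⊆_)
open import Relation.Nullary using (¬_)
open import Relation.Binary.PropositionalEquality using (_≡_; _≢_)
open import Function.Bundles using (_⇔_)

data Step : Set where
  U D : Step

DyckFrom : ℕ → List Step → Set
DyckFrom zero    []      = ⊤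
DyckFrom (suc h) []      = ⊥
DyckFrom h       (U ∷ w) = DyckFrom (suc h) w
DyckFrom zero    (D ∷ w) = ⊥
DyckFrom (suc h) (D ∷ w) = DyckFrom h w

Dyck : ℕ → List Step → Set
Dyck n w = (length w ≡ 2 * n) × DyckFrom 0 w

Factor : List Step → List Step → Set
Factor α w = ∃[ u ] ∃[ v ] (w ≡ u ++ α ++ v)

Avoids : List Step → List Step → Set
Avoids α w = ¬ Factor α w

F : ℕ → ℕ → List Step → Set
F p n w = Dyck n w × Avoids (D ∷ U ∷ U ∷ []) w × Avoids (replicate (suc p) D) w

stepVal : Step → ℤ
stepVal U = + 1
stepVal D = - (+ 1)

heightOf : List Step → ℤ
heightOf []      = + 0
heightOf (s ∷ w) = stepVal s ℤ.+ heightOf w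

hAt : List Step → ℕ → ℤ
hAt w i = heightOf (take i w)

_≤S_ : List Step → List Step → Set
P ≤S Q = ∀ i → hAt P i ℤ.≤ hAt Q i

InInterval : ℕ → ℕ → List Step → List Step → List Step → Set
InInterval p n P Q R = F p n R × P ≤S R × R ≤S Q

-- [P,Q] is boolean: isomorphic as a poset to the lattice of subsets of
-- some finite set (w.l.o.g. Fin m, i.e. Subset m ordered by ⊆).
-- f : [P,Q] → Subset m and g : Subset m → [P,Q] mutually inverse,
-- and f is an order embedding.
IsBoolean : ℕ → ℕ → List Step → List Step → Set
IsBoolean p n P Q =
  ∃[ m ] Σ ((R : List Step) → InInterval p n P Q R → Subset m) λ f →
         Σ (Subset m → List Step) λ g →
         Σ ((S : Subset m) → InInterval p n P Q (g S)) λ gIn →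
             (∀ R (r : InInterval p n P Q R) → g (f R r) ≡ R)
           × (∀ S → f (g S) (gIn S) ≡ S)
           × (∀ R R' (r : InInterval p n P Q R) (r' : InInterval p n P Q R') →
                (R ≤S R') ⇔ (f R r ⊆ f R' r'))

Covers : ℕ → ℕ → List Step → List Step → Set
Covers p n R R' =
  R ≤S R' × R ≢ R' ×
  (∀ T → F p n T → R ≤S T → T ≤S R' → (T ≡ R) ⊎ (T ≡ R'))

data MaxChain (p n : ℕ) : ℕ → List Step → List Step → Set where
  done : ∀ {P} → MaxChain p n 0 P P
  step : ∀ {k P R Q} → F p n R → Covers p n P R → MaxChain p n k R Q →
         MaxChain p n (suc k) P Q

BoolInterval : ℕ → ℕ → ℕ → List Step × List Step → Set
BoolInterval p n k (P , Q) =
  F p n P × F p n Q × P ≤S Q × IsBoolean p n P Q × MaxChain p n k P Q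

HasCount : {A : Set} → (A → Set) → ℕ → Set
HasCount {A} Pr c =
  Σ (List A) λ L → Unique L × (∀ x → (x ∈ L) ⇔ Pr x) × (length L ≡ c)

-- Formal power series in x, y over ℤ (coefficient functions) and
-- polynomials as lists of monomials (coefficient, x-exponent, y-exponent)

Series : Set
Series = ℕ → ℕ → ℤ

Poly : Set
Poly = List (ℤ × ℕ × ℕ)

coeff : Poly → Series
coeff []                  i j = + 0
coeff ((c , a , b) ∷ ps)  i j =
  (if (a ≡ᵇ i) ∧ (b ≡ᵇ j) then c else + 0) ℤ.+ coeff ps i j

sumTo : ℕ → (ℕ → ℤ) → ℤ
sumTo zero    f = f 0
sumTo (suc n) f = sumTo n f ℤ.+ f (suc n)

_⋆_ : Series → Series → Series
(A ⋆ B) n k = sumTo n λ i → sumTo k λ j → A i j ℤ.* B (n ∸ i) (k ∸ j)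

-- numerator (1-x)(1+y x^p) = 1 - x + y x^p - y x^{p+1}
numer : ℕ → Poly
numer p = (+ 1 , 0 , 0) ∷ (- (+ 1) , 1 , 0) ∷ (+ 1 , p , 1)
        ∷ (- (+ 1) , suc p , 1) ∷ []

denom : ℕ → Poly
denom p = (+ 1 , 0 , 0) ∷ (- (+ 2) , 1 , 0) ∷ (+ 1 , suc p , 0)
        ∷ (- (+ 1) , 2 , 1) ∷ (+ 1 , p , 1)
        ∷ (- (+ 1) , suc p , 1) ∷ (+ 1 , suc (suc p) , 1) ∷ []

-- A path of 𝓕ₙᵖ is U D^{d₀} ⋯ U D^{d_{n-1}} with every dᵢ ≤ p and, after some leading zeros,
-- every dᵢ ≥ 1; the Stanley order compares the partial sums d₀ + ⋯ + d_{i-1}.  An interval [P, Q]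
-- is boolean exactly when Q arises from P by flipping (turning DU into UD) a set of valleys of P
-- that can be flipped simultaneously inside 𝓕ₙᵖ, and its height is the number of flipped valleys:
-- the subsets of the flips give the isomorphism with a lattice of subsets, and conversely every atom
-- of a boolean interval lies above a single flip of P, so Q is P with all these flips performed.
-- Splitting such marked descent sequences at their first block gives, for the series T₀ and T₁
-- of tails behind a non-flippable resp. flippable valley and for the series B of intervals,
--   T₀ = 1 + x T₀ + (x² + ⋯ + xᵖ) T₁,   T₁ = T₀ + x y T₀ + y (x² + ⋯ + xᵖ⁻¹) T₁,
--   B = 1 + (x + ⋯ + xᵖ) T₁,
-- and eliminating T₀ and T₁ gives K B = 1 + y xᵖ, where (1 - x) K is the denominator.

module Submission where

open import Defs
open import Data.Nat using (ℕ; _≤_)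

module PowerSeries where

  open import Data.Nat using (ℕ; zero; suc; _∸_; _≡ᵇ_)
  open import Data.Integer as ℤ using (ℤ; +_; -_; _+_; _*_; _-_)
  import Data.Integer.Properties as ℤ
  open import Data.Integer.Tactic.RingSolver using (solve-∀)
  open import Data.Bool using (true; false; _∧_; if_then_else_)
  open import Data.Product using (_,_)
  open import Data.List using ([]; _∷_)
  open import Relation.Binary.Bundles using (Setoid)
  open import Relation.Binary.PropositionalEquality
    using (_≡_; refl; sym; trans; cong; cong₂; module ≡-Reasoning)

  infix 4 _≈_
  infixl 6 _⊕_ _⊖_

  _≈_ : Series → Series → Set
  s ≈ t = ∀ n k → s n k ≡ t n k

  ≈-setoid : Setoid _ _
  ≈-setoid = record
    { Carrier       = Series
    ; _≈_           = _≈_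
    ; isEquivalence = record
      { refl  = λ _ _ → refl
      ; sym   = λ e n k → sym (e n k)
      ; trans = λ e f n k → trans (e n k) (f n k)
      }
    }

  open Setoid ≈-setoid public using () renaming (refl to ≈-refl; sym to ≈-sym; trans to ≈-trans)

  _⊕_ _⊖_ : Series → Series → Series
  (s ⊕ t) n k = s n k + t n k
  (s ⊖ t) n k = s n k - t n k

  δ : Series
  δ zero    zero    = + 1
  δ zero    (suc k) = + 0
  δ (suc n) k       = + 0

  X Y : Series → Series
  X s zero    k       = + 0
  X s (suc n) k       = s n k
  Y s n       zero    = + 0
  Y s n       (suc k) = s n k

  X^ Y^ : ℕ → Series → Series
  X^ zero    s = s
  X^ (suc a) s = X (X^ a s)
  Y^ zero    s = s
  Y^ (suc b) s = Y (Y^ b s)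

  -- multiplication by x + x² + ⋯ + xᵐ
  geom : ℕ → Series → Series
  geom zero    s n k = + 0
  geom (suc m) s n k = X s n k + X (geom m s) n k

  ⊕-cong : ∀ {s s′ t t′} → s ≈ s′ → t ≈ t′ → s ⊕ t ≈ s′ ⊕ t′
  ⊕-cong e f n k = cong₂ _+_ (e n k) (f n k)

  ⊖-cong : ∀ {s s′ t t′} → s ≈ s′ → t ≈ t′ → s ⊖ t ≈ s′ ⊖ t′
  ⊖-cong e f n k = cong₂ _-_ (e n k) (f n k)

  X-cong : ∀ {s t} → s ≈ t → X s ≈ X t
  X-cong e zero    k = refl
  X-cong e (suc n) k = e n k

  Y-cong : ∀ {s t} → s ≈ t → Y s ≈ Y t
  Y-cong e n zero    = refl
  Y-cong e n (suc k) = e n k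

  X^-cong : ∀ a {s t} → s ≈ t → X^ a s ≈ X^ a t
  X^-cong zero    e = e
  X^-cong (suc a) e = X-cong (X^-cong a e)

  Y^-cong : ∀ b {s t} → s ≈ t → Y^ b s ≈ Y^ b t
  Y^-cong zero    e = e
  Y^-cong (suc b) e = Y-cong (Y^-cong b e)

  geom-cong : ∀ m {s t} → s ≈ t → geom m s ≈ geom m t
  geom-cong zero    e n k = refl
  geom-cong (suc m) e n k = cong₂ _+_ (X-cong e n k) (X-cong (geom-cong m e) n k)

  X-⊕ : ∀ s t → X (s ⊕ t) ≈ X s ⊕ X t
  X-⊕ s t zero    k = refl
  X-⊕ s t (suc n) k = refl

  X-⊖ : ∀ s t → X (s ⊖ t) ≈ X s ⊖ X t
  X-⊖ s t zero    k = refl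
  X-⊖ s t (suc n) k = refl

  Y-⊕ : ∀ s t → Y (s ⊕ t) ≈ Y s ⊕ Y t
  Y-⊕ s t n zero    = refl
  Y-⊕ s t n (suc k) = refl

  Y-⊖ : ∀ s t → Y (s ⊖ t) ≈ Y s ⊖ Y t
  Y-⊖ s t n zero    = refl
  Y-⊖ s t n (suc k) = refl

  X^-⊕ : ∀ a s t → X^ a (s ⊕ t) ≈ X^ a s ⊕ X^ a t
  X^-⊕ zero    s t = ≈-refl
  X^-⊕ (suc a) s t = ≈-trans (X-cong (X^-⊕ a s t)) (X-⊕ (X^ a s) (X^ a t))

  geom-⊕ : ∀ m s t → geom m (s ⊕ t) ≈ geom m s ⊕ geom m t
  geom-⊕ zero    s t n k = refl
  geom-⊕ (suc m) s t n k =
    trans (cong₂ _+_ (X-⊕ s t n k) (≈-trans (X-cong (geom-⊕ m s t)) (X-⊕ _ _) n k))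
          (interchange (X s n k) _ _ _)
    where
    interchange : ∀ a b c d → (a + b) + (c + d) ≡ (a + c) + (b + d)
    interchange = solve-∀

  geom-⊖ : ∀ m s t → geom m (s ⊖ t) ≈ geom m s ⊖ geom m t
  geom-⊖ zero    s t n k = refl
  geom-⊖ (suc m) s t n k =
    trans (cong₂ _+_ (X-⊖ s t n k) (≈-trans (X-cong (geom-⊖ m s t)) (X-⊖ _ _) n k))
          (interchange (X s n k) _ _ _)
    where
    interchange : ∀ a b c d → (a - b) + (c - d) ≡ (a + c) - (b + d)
    interchange = solve-∀

  X-Y : ∀ s → X (Y s) ≈ Y (X s)
  X-Y s zero    zero    = refl
  X-Y s zero    (suc k) = refl
  X-Y s (suc n) zero    = refl
  X-Y s (suc n) (suc k) = refl

  X-geom : ∀ m s → X (geom m s) ≈ geom m (X s)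
  X-geom zero    s zero    k = refl
  X-geom zero    s (suc n) k = refl
  X-geom (suc m) s zero    k = refl
  X-geom (suc m) s (suc n) k = cong (λ z → X s n k + z) (X-geom m s n k)

  Y-geom : ∀ m s → Y (geom m s) ≈ geom m (Y s)
  Y-geom zero    s n       zero    = refl
  Y-geom zero    s n       (suc k) = refl
  Y-geom (suc m) s zero    zero    = refl
  Y-geom (suc m) s (suc n) zero    = trans (Y-geom m s n zero) (sym (ℤ.+-identityˡ _))
  Y-geom (suc m) s n       (suc k) =
    cong₂ _+_ (sym (X-Y s n (suc k))) (trans (sym (X-Y (geom m s) n (suc k))) (X-cong (Y-geom m s) n (suc k)))

  X^-geom : ∀ a m s → X^ a (geom m s) ≈ geom m (X^ a s)
  X^-geom zero    m s = ≈-refl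
  X^-geom (suc a) m s = ≈-trans (X-cong (X^-geom a m s)) (X-geom m (X^ a s))

  Y-X^ : ∀ a s → Y (X^ a s) ≈ X^ a (Y s)
  Y-X^ zero    s = ≈-refl
  Y-X^ (suc a) s = ≈-trans (≈-sym (X-Y (X^ a s))) (X-cong (Y-X^ a s))

  geom-zero : ∀ m → geom m (λ _ _ → + 0) ≈ (λ _ _ → + 0)
  geom-zero zero    n       k = refl
  geom-zero (suc m) zero    k = refl
  geom-zero (suc m) (suc n) k = trans (ℤ.+-identityˡ _) (geom-zero m n k)

  geom-geom : ∀ a b s → geom a (geom b s) ≈ geom b (geom a s)
  geom-geom zero    b s = ≈-sym (geom-zero b)
  geom-geom (suc a) b s = ≈-trans
    (⊕-cong (X-geom b s) (≈-trans (X-cong (geom-geom a b s)) (X-geom b (geom a s))))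
    (≈-sym (geom-⊕ b (X s) (X (geom a s))))

  geom-suc : ∀ m s → geom (suc m) s ≈ geom m s ⊕ X^ (suc m) s
  geom-suc zero    s zero    k = refl
  geom-suc zero    s (suc n) k = trans (ℤ.+-identityʳ (s n k)) (sym (ℤ.+-identityˡ (s n k)))
  geom-suc (suc m) s zero    k = refl
  geom-suc (suc m) s (suc n) k =
    trans (cong (λ z → s n k + z) (geom-suc m s n k)) (sym (ℤ.+-assoc (s n k) _ _))

  geom-telescope : ∀ m s → geom m s ⊖ X (geom m s) ≈ X s ⊖ X^ (suc m) s
  geom-telescope zero    s zero    k = refl
  geom-telescope zero    s (suc n) k = sym (ℤ.+-inverseʳ (s n k))
  geom-telescope (suc m) s zero    k = refl
  geom-telescope (suc m) s (suc n) k = begin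
    (s n k + geom m s n k) - (X s n k + X (geom m s) n k)
      ≡⟨ regroup (s n k) _ _ _ ⟩
    (s n k - X s n k) + (geom m s n k - X (geom m s) n k)
      ≡⟨ cong (λ z → (s n k - X s n k) + z) (geom-telescope m s n k) ⟩
    (s n k - X s n k) + (X s n k - X^ (suc m) s n k)
      ≡⟨ cancel (s n k) _ _ ⟩
    s n k - X^ (suc m) s n k ∎
    where
    open ≡-Reasoning
    regroup : ∀ a b c d → (a + b) - (c + d) ≡ (a - c) + (b - d)
    regroup = solve-∀
    cancel : ∀ a b c → (a - b) + (b - c) ≡ a - c
    cancel = solve-∀

  Y-X-telescope : ∀ m s → Y (X (geom m s)) ⊖ X (Y (X (geom m s))) ≈ X^ 2 (Y s) ⊖ X^ (suc (suc m)) (Y s)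
  Y-X-telescope m s = begin
    Y (X W) ⊖ X (Y (X W))              ≈⟨ ⊖-cong {Y (X W)} ≈-refl (X-Y (X W)) ⟩
    Y (X W) ⊖ Y (X (X W))              ≈⟨ ≈-sym (Y-⊖ (X W) (X (X W))) ⟩
    Y (X W ⊖ X (X W))                  ≈⟨ Y-cong (≈-sym (X-⊖ W (X W))) ⟩
    Y (X (W ⊖ X W))                    ≈⟨ Y-cong (X-cong (geom-telescope m s)) ⟩
    Y (X (X s ⊖ X^ (suc m) s))         ≈⟨ Y-cong (X-⊖ (X s) (X^ (suc m) s)) ⟩
    Y (X^ 2 s ⊖ X^ (suc (suc m)) s)    ≈⟨ Y-⊖ (X^ 2 s) (X^ (suc (suc m)) s) ⟩
    Y (X^ 2 s) ⊖ Y (X^ (suc (suc m)) s) ≈⟨ ⊖-cong (Y-X^ 2 s) (Y-X^ (suc (suc m)) s) ⟩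
    X^ 2 (Y s) ⊖ X^ (suc (suc m)) (Y s) ∎
    where
    open import Relation.Binary.Reasoning.Setoid ≈-setoid
    W : Series
    W = geom m s

  infixr 7 _∙_
  _∙_ : Poly → Series → Series
  ([]                  ∙ s) n k = + 0
  (((c , a , b) ∷ P)   ∙ s) n k = c * X^ a (Y^ b s) n k + (P ∙ s) n k

  ∙-cong : ∀ P {s t} → s ≈ t → P ∙ s ≈ P ∙ t
  ∙-cong []                e n k = refl
  ∙-cong ((c , a , b) ∷ P) e n k =
    cong₂ _+_ (cong (c *_) (X^-cong a (Y^-cong b e) n k)) (∙-cong P e n k)

  sumTo-cong : ∀ n {f g : ℕ → ℤ} → (∀ i → f i ≡ g i) → sumTo n f ≡ sumTo n g
  sumTo-cong zero    e = e 0
  sumTo-cong (suc n) e = cong₂ _+_ (sumTo-cong n e) (e (suc n))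

  sumTo-distrib : ∀ n (f g : ℕ → ℤ) → sumTo n (λ i → f i + g i) ≡ sumTo n f + sumTo n g
  sumTo-distrib zero    f g = refl
  sumTo-distrib (suc n) f g =
    trans (cong (λ z → z + (f (suc n) + g (suc n))) (sumTo-distrib n f g))
          (interchange (sumTo n f) (sumTo n g) (f (suc n)) (g (suc n)))
    where
    interchange : ∀ a b c d → (a + b) + (c + d) ≡ (a + c) + (b + d)
    interchange = solve-∀

  sumTo-suc : ∀ n (f : ℕ → ℤ) → sumTo (suc n) f ≡ f 0 + sumTo n (λ i → f (suc i))
  sumTo-suc zero    f = refl
  sumTo-suc (suc n) f =
    trans (cong (λ z → z + f (suc (suc n))) (sumTo-suc n f)) (ℤ.+-assoc (f 0) _ _)

  sumTo-zero : ∀ n {f : ℕ → ℤ} → (∀ i → f i ≡ + 0) → sumTo n f ≡ + 0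
  sumTo-zero zero    e = e 0
  sumTo-zero (suc n) e = cong₂ _+_ (sumTo-zero n e) (e (suc n))

  sift-Y : ∀ c b (s : Series) n k →
    sumTo k (λ j → (if b ≡ᵇ j then c else + 0) * s n (k ∸ j)) ≡ c * Y^ b s n k
  sift-Y c zero    s n zero    = refl
  sift-Y c zero    s n (suc k) = begin
    sumTo (suc k) (λ j → (if 0 ≡ᵇ j then c else + 0) * s n (suc k ∸ j))
      ≡⟨ sumTo-suc k _ ⟩
    c * s n (suc k) + sumTo k (λ j → + 0 * s n (k ∸ j))
      ≡⟨ cong (λ z → c * s n (suc k) + z) (sumTo-zero k (λ j → ℤ.*-zeroˡ (s n (k ∸ j)))) ⟩
    c * s n (suc k) + + 0
      ≡⟨ ℤ.+-identityʳ _ ⟩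
    c * s n (suc k) ∎
    where open ≡-Reasoning
  sift-Y c (suc b) s n zero    = sym (ℤ.*-zeroʳ c)
  sift-Y c (suc b) s n (suc k) = begin
    sumTo (suc k) (λ j → (if suc b ≡ᵇ j then c else + 0) * s n (suc k ∸ j))
      ≡⟨ sumTo-suc k _ ⟩
    + 0 * s n (suc k) + sumTo k (λ j → (if b ≡ᵇ j then c else + 0) * s n (k ∸ j))
      ≡⟨ cong (λ z → z + sumTo k (λ j → (if b ≡ᵇ j then c else + 0) * s n (k ∸ j))) (ℤ.*-zeroˡ (s n (suc k))) ⟩
    + 0 + sumTo k (λ j → (if b ≡ᵇ j then c else + 0) * s n (k ∸ j))
      ≡⟨ ℤ.+-identityˡ _ ⟩
    sumTo k (λ j → (if b ≡ᵇ j then c else + 0) * s n (k ∸ j))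
      ≡⟨ sift-Y c b s n k ⟩
    c * Y^ b s n k ∎
    where open ≡-Reasoning

  sift-X : ∀ a (v : Series) n k →
    sumTo n (λ i → if a ≡ᵇ i then v (n ∸ i) k else + 0) ≡ X^ a v n k
  sift-X zero    v zero    k = refl
  sift-X zero    v (suc n) k =
    trans (sumTo-suc n _) (trans (cong (λ z → v (suc n) k + z) (sumTo-zero n (λ _ → refl))) (ℤ.+-identityʳ _))
  sift-X (suc a) v zero    k = refl
  sift-X (suc a) v (suc n) k = trans (sumTo-suc n _) (trans (ℤ.+-identityˡ _) (sift-X a v n k))

  X^-scale : ∀ a c (v : Series) n k → X^ a (λ m j → c * v m j) n k ≡ c * X^ a v n k
  X^-scale zero    c v n       k = refl
  X^-scale (suc a) c v zero    k = sym (ℤ.*-zeroʳ c)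
  X^-scale (suc a) c v (suc n) k = X^-scale a c v n k

  monomial-⋆ : ∀ c a b (s : Series) n k →
    sumTo n (λ i → sumTo k (λ j → (if (a ≡ᵇ i) ∧ (b ≡ᵇ j) then c else + 0) * s (n ∸ i) (k ∸ j)))
    ≡ c * X^ a (Y^ b s) n k
  monomial-⋆ c a b s n k = begin
    sumTo n (λ i → sumTo k (λ j → (if (a ≡ᵇ i) ∧ (b ≡ᵇ j) then c else + 0) * s (n ∸ i) (k ∸ j)))
      ≡⟨ sumTo-cong n row ⟩
    sumTo n (λ i → if a ≡ᵇ i then c * Y^ b s (n ∸ i) k else + 0)
      ≡⟨ sift-X a (λ m j → c * Y^ b s m j) n k ⟩
    X^ a (λ m j → c * Y^ b s m j) n k
      ≡⟨ X^-scale a c (Y^ b s) n k ⟩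
    c * X^ a (Y^ b s) n k ∎
    where
    open ≡-Reasoning
    row : ∀ i → sumTo k (λ j → (if (a ≡ᵇ i) ∧ (b ≡ᵇ j) then c else + 0) * s (n ∸ i) (k ∸ j))
              ≡ (if a ≡ᵇ i then c * Y^ b s (n ∸ i) k else + 0)
    row i with a ≡ᵇ i
    ... | true  = sift-Y c b s (n ∸ i) k
    ... | false = sumTo-zero k (λ j → ℤ.*-zeroˡ (s (n ∸ i) (k ∸ j)))

  coeff-⋆ : ∀ P s → coeff P ⋆ s ≈ P ∙ s
  coeff-⋆ []                s n k =
    sumTo-zero n (λ i → sumTo-zero k (λ j → ℤ.*-zeroˡ (s (n ∸ i) (k ∸ j))))
  coeff-⋆ ((c , a , b) ∷ P) s n k = begin
    sumTo n (λ i → sumTo k (λ j → (m i j + coeff P i j) * s (n ∸ i) (k ∸ j)))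
      ≡⟨ sumTo-cong n (λ i → trans (sumTo-cong k (λ j → ℤ.*-distribʳ-+ (s (n ∸ i) (k ∸ j)) (m i j) _))
                                  (sumTo-distrib k _ _)) ⟩
    sumTo n (λ i → sumTo k (λ j → m i j * s (n ∸ i) (k ∸ j)) + sumTo k (λ j → coeff P i j * s (n ∸ i) (k ∸ j)))
      ≡⟨ sumTo-distrib n _ _ ⟩
    sumTo n (λ i → sumTo k (λ j → m i j * s (n ∸ i) (k ∸ j))) + (coeff P ⋆ s) n k
      ≡⟨ cong₂ _+_ (monomial-⋆ c a b s n k) (coeff-⋆ P s n k) ⟩
    c * X^ a (Y^ b s) n k + (P ∙ s) n k ∎
    where
    open ≡-Reasoning
    m : ℕ → ℕ → ℤ
    m i j = if (a ≡ᵇ i) ∧ (b ≡ᵇ j) then c else + 0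

  X^Y^-δ : ∀ a b n k → X^ a (Y^ b δ) n k ≡ (if (a ≡ᵇ n) ∧ (b ≡ᵇ k) then + 1 else + 0)
  X^Y^-δ zero    b n       k = Y^-δ b n k
    where
    Y^-δ : ∀ b n k → Y^ b δ n k ≡ (if (0 ≡ᵇ n) ∧ (b ≡ᵇ k) then + 1 else + 0)
    Y^-δ zero    zero    zero    = refl
    Y^-δ zero    zero    (suc k) = refl
    Y^-δ zero    (suc n) k       = refl
    Y^-δ (suc b) zero    zero    = refl
    Y^-δ (suc b) (suc n) zero    = refl
    Y^-δ (suc b) n       (suc k) = Y^-δ b n k
  X^Y^-δ (suc a) b zero    k = refl
  X^Y^-δ (suc a) b (suc n) k = X^Y^-δ a b n k

  coeff-δ : ∀ P → coeff P ≈ P ∙ δ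
  coeff-δ []                n k = refl
  coeff-δ ((c , a , b) ∷ P) n k =
    cong₂ _+_ (trans (scale ((a ≡ᵇ n) ∧ (b ≡ᵇ k))) (cong (c *_) (sym (X^Y^-δ a b n k))))
              (coeff-δ P n k)
    where
    scale : ∀ t → (if t then c else + 0) ≡ c * (if t then + 1 else + 0)
    scale true  = sym (ℤ.*-identityʳ c)
    scale false = sym (ℤ.*-zeroʳ c)

  module GeneratingFunction (q : ℕ) where

    p : ℕ
    p = suc (suc q)

    -- K = 1 - (x + ⋯ + xᵖ) - y (x² + ⋯ + xᵖ⁻¹) - y xᵖ⁺¹, so that denom p = (1 - x) K
    K : Series → Series
    K u = u ⊖ geom p u ⊖ Y (X (geom q u)) ⊖ Y (X^ (suc p) u)

    Δ : Series → Series
    Δ v = v ⊖ X v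

    K-cong : ∀ {u v} → u ≈ v → K u ≈ K v
    K-cong e = ⊖-cong (⊖-cong (⊖-cong e (geom-cong p e)) (Y-cong (X-cong (geom-cong q e))))
                      (Y-cong (X^-cong (suc p) e))

    K-⊕ : ∀ u v → K (u ⊕ v) ≈ K u ⊕ K v
    K-⊕ u v n k =
      trans (cong₃ {d = u n k + v n k} (geom-⊕ p u v n k)
                   (≈-trans (Y-cong (≈-trans (X-cong (geom-⊕ q u v)) (X-⊕ (geom q u) (geom q v))))
                            (Y-⊕ (X (geom q u)) (X (geom q v))) n k)
                   (≈-trans (Y-cong (X^-⊕ (suc p) u v)) (Y-⊕ (X^ (suc p) u) (X^ (suc p) v)) n k))
            (regroup (u n k) (v n k) _ _ _ _ _ _)
      where
      cong₃ : ∀ {a a′ b b′ c c′ d : ℤ} → a ≡ a′ → b ≡ b′ → c ≡ c′ → d - a - b - c ≡ d - a′ - b′ - c′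
      cong₃ refl refl refl = refl
      regroup : ∀ a b c d e f g h →
        (a + b) - (c + d) - (e + f) - (g + h) ≡ (a - c - e - g) + (b - d - f - h)
      regroup = solve-∀

    K-geom : ∀ u → K (geom p u) ≈ geom p (K u)
    K-geom u = ≈-sym (≈-trans (geom-⊖ p _ _) (⊖-cong (≈-trans (geom-⊖ p _ _)
                 (⊖-cong (geom-⊖ p u (geom p u)) (≈-sym middle))) (≈-sym last)))
      where
      middle : Y (X (geom q (geom p u))) ≈ geom p (Y (X (geom q u)))
      middle = ≈-trans (Y-cong (X-cong (geom-geom q p u)))
                 (≈-trans (Y-cong (X-geom p (geom q u))) (Y-geom p (X (geom q u))))
      last : Y (X^ (suc p) (geom p u)) ≈ geom p (Y (X^ (suc p) u))
      last = ≈-trans (Y-cong (X^-geom (suc p) p u)) (Y-geom p (X^ (suc p) u))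

    module _ {F T : Series}
             (F-eq : F ≈ δ ⊕ X F ⊕ X (geom (suc q) T))
             (T-eq : T ≈ F ⊕ Y (X F) ⊕ Y (X (geom q T))) where

      -- K T - δ - x y δ is the combination T-eq + F-eq - x T-eq + y x F-eq of the defining equations
      K-tails : K T ≈ δ ⊕ X (Y δ)
      K-tails n k =
        trans (combine (δ n k) (X F n k) (X (geom (suc q) T) n k) (Y (X W) n k) (Y (X^ (suc p) T) n k)
                       (X (Y (X F)) n k) (X (Y (X W)) n k) (Y (X δ) n k)
                       (T-eq n k) (F-eq n k) (xT-eq n k) (yxF-eq n k))
              (cong (λ z → δ n k + z) (sym (X-Y δ n k)))
        where
        open import Relation.Binary.Reasoning.Setoid ≈-setoid
        W : Series
        W = geom q T
        xT-eq : X T ≈ X F ⊕ X (Y (X F)) ⊕ X (Y (X W))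
        xT-eq = ≈-trans (X-cong T-eq) (≈-trans (X-⊕ (F ⊕ Y (X F)) (Y (X W))) (⊕-cong (X-⊕ F (Y (X F))) ≈-refl))
        yxF-eq : Y (X F) ≈ (Y (X δ) ⊕ X (Y (X F))) ⊕ (X (Y (X W)) ⊕ Y (X^ (suc p) T))
        yxF-eq = begin
          Y (X F)
            ≈⟨ Y-cong (X-cong F-eq) ⟩
          Y (X (δ ⊕ X F ⊕ X (geom (suc q) T)))
            ≈⟨ Y-cong (≈-trans (X-⊕ (δ ⊕ X F) _) (⊕-cong (X-⊕ δ (X F)) ≈-refl)) ⟩
          Y (X δ ⊕ X (X F) ⊕ X (X (geom (suc q) T)))
            ≈⟨ ≈-trans (Y-⊕ (X δ ⊕ X (X F)) _) (⊕-cong (Y-⊕ (X δ) (X (X F))) ≈-refl) ⟩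
          Y (X δ) ⊕ Y (X (X F)) ⊕ Y (X (X (geom (suc q) T)))
            ≈⟨ ⊕-cong (⊕-cong {Y (X δ)} ≈-refl (≈-sym (X-Y (X F)))) (Y-cong (X-cong (X-cong (geom-suc q T)))) ⟩
          Y (X δ) ⊕ X (Y (X F)) ⊕ Y (X (X (W ⊕ X^ (suc q) T)))
            ≈⟨ ⊕-cong {Y (X δ) ⊕ X (Y (X F))} ≈-refl
                      (≈-trans (Y-cong (≈-trans (X-cong (X-⊕ W (X^ (suc q) T))) (X-⊕ (X W) (X^ p T))))
                               (Y-⊕ (X (X W)) (X^ (suc p) T))) ⟩
          Y (X δ) ⊕ X (Y (X F)) ⊕ (Y (X (X W)) ⊕ Y (X^ (suc p) T))
            ≈⟨ ⊕-cong {Y (X δ) ⊕ X (Y (X F))} ≈-refl (⊕-cong (≈-sym (X-Y (X W))) (≈-refl {Y (X^ (suc p) T)})) ⟩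
          Y (X δ) ⊕ X (Y (X F)) ⊕ (X (Y (X W)) ⊕ Y (X^ (suc p) T)) ∎
        combine : ∀ {t f xt yxf : ℤ} (d xf xgT yxW yx^T xyxf xyxW yxd : ℤ) →
          t ≡ f + yxf + yxW → f ≡ d + xf + xgT → xt ≡ xf + xyxf + xyxW →
          yxf ≡ (yxd + xyxf) + (xyxW + yx^T) →
          t - (xt + xgT) - yxW - yx^T ≡ d + yxd
        combine d xf xgT yxW yx^T xyxf xyxW yxd refl refl refl refl = linear d xf xgT yxW yx^T xyxf xyxW yxd
          where
          linear : ∀ d xf xgT yxW yx^T xyxf xyxW yxd →
            ((d + xf + xgT) + ((yxd + xyxf) + (xyxW + yx^T)) + yxW)
              - ((xf + xyxf + xyxW) + xgT) - yxW - yx^T ≡ d + yxd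
          linear = solve-∀

      K-boolean : ∀ {B} → B ≈ δ ⊕ geom p T → K B ≈ δ ⊕ Y (X^ p δ)
      K-boolean {B} B-eq = begin
        K B                                     ≈⟨ K-cong B-eq ⟩
        K (δ ⊕ geom p T)                        ≈⟨ K-⊕ δ (geom p T) ⟩
        K δ ⊕ K (geom p T)                      ≈⟨ ⊕-cong {K δ} ≈-refl (K-geom T) ⟩
        K δ ⊕ geom p (K T)                      ≈⟨ ⊕-cong {K δ} ≈-refl (geom-cong p K-tails) ⟩
        K δ ⊕ geom p (δ ⊕ X (Y δ))              ≈⟨ ⊕-cong {K δ} ≈-refl (geom-⊕ p δ (X (Y δ))) ⟩
        K δ ⊕ (geom p δ ⊕ geom p (X (Y δ)))     ≈⟨ ⊕-cong {K δ} ≈-refl (⊕-cong {geom p δ} ≈-refl geom-XYδ) ⟩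
        K δ ⊕ (geom p δ ⊕ (Y (X (geom q δ)) ⊕ Y (X^ p δ) ⊕ Y (X^ (suc p) δ)))
                                                ≈⟨ (λ n k → cancel (δ n k) _ _ _ _) ⟩
        δ ⊕ Y (X^ p δ)                          ∎
        where
        open import Relation.Binary.Reasoning.Setoid ≈-setoid
        geom-δ : geom p δ ≈ geom q δ ⊕ X^ (suc q) δ ⊕ X^ p δ
        geom-δ = ≈-trans (geom-suc (suc q) δ) (⊕-cong (geom-suc q δ) ≈-refl)
        geom-XYδ : geom p (X (Y δ)) ≈ Y (X (geom q δ)) ⊕ Y (X^ p δ) ⊕ Y (X^ (suc p) δ)
        geom-XYδ = begin
          geom p (X (Y δ))                                ≈⟨ ≈-sym (X-geom p (Y δ)) ⟩
          X (geom p (Y δ))                                ≈⟨ X-cong (≈-sym (Y-geom p δ)) ⟩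
          X (Y (geom p δ))                                ≈⟨ X-Y (geom p δ) ⟩
          Y (X (geom p δ))                                ≈⟨ Y-cong (X-cong geom-δ) ⟩
          Y (X (geom q δ ⊕ X^ (suc q) δ ⊕ X^ p δ))
            ≈⟨ Y-cong (≈-trans (X-⊕ (geom q δ ⊕ X^ (suc q) δ) (X^ p δ))
                               (⊕-cong (X-⊕ (geom q δ) (X^ (suc q) δ)) ≈-refl)) ⟩
          Y (X (geom q δ) ⊕ X^ p δ ⊕ X^ (suc p) δ)
            ≈⟨ ≈-trans (Y-⊕ (X (geom q δ) ⊕ X^ p δ) (X^ (suc p) δ))
                       (⊕-cong (Y-⊕ (X (geom q δ)) (X^ p δ)) ≈-refl) ⟩
          Y (X (geom q δ)) ⊕ Y (X^ p δ) ⊕ Y (X^ (suc p) δ) ∎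
        cancel : ∀ d w a b c → (d - w - a - c) + (w + (a + b + c)) ≡ d + b
        cancel = solve-∀

    -- (1 - x) K u, expanded with three telescoping sums
    denom-∙ : ∀ u → denom p ∙ u ≈ Δ (K u)
    denom-∙ u n k = begin
      (denom p ∙ u) n k
        ≡⟨ expand (u n k) (X u n k) (X^ (suc p) u n k) (X^ 2 (Y u) n k) (X^ p (Y u) n k)
                  (X^ (suc p) (Y u) n k) (X^ (suc (suc p)) (Y u) n k) ⟩
      (u n k - X u n k) - (X u n k - X^ (suc p) u n k) - (X^ 2 (Y u) n k - X^ p (Y u) n k)
        - (X^ (suc p) (Y u) n k - X^ (suc (suc p)) (Y u) n k)
        ≡⟨ cong₃ {u n k - X u n k} (sym (geom-telescope p u n k)) (sym (Y-X-telescope q u n k)) (sym (telescope-y n k)) ⟩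
      (u n k - X u n k) - (geom p u n k - X (geom p u) n k) - (Y (X W) n k - X (Y (X W)) n k)
        - (Y (X^ (suc p) u) n k - X (Y (X^ (suc p) u)) n k)
        ≡⟨ regroup (u n k) (X u n k) (geom p u n k) _ (Y (X W) n k) _ (Y (X^ (suc p) u) n k) _ ⟩
      K u n k - (X u n k - X (geom p u) n k - X (Y (X W)) n k - X (Y (X^ (suc p) u)) n k)
        ≡⟨ cong (λ z → K u n k - z) (sym (X-K n k)) ⟩
      Δ (K u) n k ∎
      where
      open ≡-Reasoning
      W : Series
      W = geom q u
      telescope-y : Y (X^ (suc p) u) ⊖ X (Y (X^ (suc p) u)) ≈ X^ (suc p) (Y u) ⊖ X^ (suc (suc p)) (Y u)
      telescope-y = ⊖-cong (Y-X^ (suc p) u) (X-cong (Y-X^ (suc p) u))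
      X-K : X (K u) ≈ X u ⊖ X (geom p u) ⊖ X (Y (X W)) ⊖ X (Y (X^ (suc p) u))
      X-K = ≈-trans (X-⊖ (u ⊖ geom p u ⊖ Y (X W)) (Y (X^ (suc p) u)))
              (⊖-cong (≈-trans (X-⊖ (u ⊖ geom p u) (Y (X W))) (⊖-cong (X-⊖ u (geom p u)) ≈-refl)) ≈-refl)
      expand : ∀ a xa z x2y xpy z′ z″ →
        + 1 * a + (- (+ 2) * xa + (+ 1 * z + (- (+ 1) * x2y + (+ 1 * xpy + (- (+ 1) * z′ + (+ 1 * z″ + + 0))))))
        ≡ (a - xa) - (xa - z) - (x2y - xpy) - (z′ - z″)
      expand = solve-∀
      cong₃ : ∀ {a b b′ c c′ d d′ : ℤ} → b ≡ b′ → c ≡ c′ → d ≡ d′ → a - b - c - d ≡ a - b′ - c′ - d′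
      cong₃ refl refl refl = refl
      regroup : ∀ a xa g xg w xw z xz → (a - xa) - (g - xg) - (w - xw) - (z - xz) ≡ (a - g - w - z) - (xa - xg - xw - xz)
      regroup = solve-∀

    numer-∙ : ∀ u → numer p ∙ u ≈ Δ (u ⊕ Y (X^ p u))
    numer-∙ u n k = begin
      + 1 * u n k + (- (+ 1) * X u n k + (+ 1 * X^ p (Y u) n k + (- (+ 1) * X^ (suc p) (Y u) n k + + 0)))
        ≡⟨ linear (u n k) (X u n k) (X^ p (Y u) n k) (X^ (suc p) (Y u) n k) ⟩
      (u n k + X^ p (Y u) n k) - (X u n k + X^ (suc p) (Y u) n k)
        ≡⟨ sym (cong₂ (λ a b → (u n k + a) - (X u n k + b)) (Y-X^ p u n k) (X-cong (Y-X^ p u) n k)) ⟩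
      (u n k + Y (X^ p u) n k) - (X u n k + X (Y (X^ p u)) n k)
        ≡⟨ cong (λ z → (u n k + Y (X^ p u) n k) - z) (sym (X-⊕ u (Y (X^ p u)) n k)) ⟩
      Δ (u ⊕ Y (X^ p u)) n k ∎
      where
      open ≡-Reasoning
      linear : ∀ a b c d → + 1 * a + (- (+ 1) * b + (+ 1 * c + (- (+ 1) * d + + 0))) ≡ (a + c) - (b + d)
      linear = solve-∀

    generating-function : ∀ {F T B : Series} →
      F ≈ δ ⊕ X F ⊕ X (geom (suc q) T) →
      T ≈ F ⊕ Y (X F) ⊕ Y (X (geom q T)) →
      B ≈ δ ⊕ geom p T →
      coeff (denom p) ⋆ B ≈ coeff (numer p)
    generating-function {F} {T} {B} F-eq T-eq B-eq = begin
      coeff (denom p) ⋆ B         ≈⟨ coeff-⋆ (denom p) B ⟩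
      denom p ∙ B                 ≈⟨ denom-∙ B ⟩
      Δ (K B)                     ≈⟨ ⊖-cong KB (X-cong KB) ⟩
      Δ (δ ⊕ Y (X^ p δ))          ≈⟨ ≈-sym (numer-∙ δ) ⟩
      numer p ∙ δ                 ≈⟨ ≈-sym (coeff-δ (numer p)) ⟩
      coeff (numer p)             ∎
      where
      open import Relation.Binary.Reasoning.Setoid ≈-setoid
      KB : K B ≈ δ ⊕ Y (X^ p δ)
      KB = K-boolean F-eq T-eq B-eq

module Counting where

  open import Data.Nat using (_+_)
  open import Data.Empty using (⊥; ⊥-elim)
  open import Data.Product using (∃; _×_; _,_)
  open import Data.Sum using (_⊎_; inj₁; inj₂)
  open import Data.List using (List; []; _∷_; _++_; map; [_])
  open import Data.List.Properties using (length-++; length-map)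
  open import Data.List.Relation.Unary.All as All using ([])
  open import Data.List.Relation.Unary.Any using (here; there)
  open import Data.List.Relation.Unary.AllPairs using ([]; _∷_)
  open import Data.List.Relation.Unary.Unique.Propositional using (Unique)
  import Data.List.Relation.Unary.Unique.Propositional.Properties as Unique
  open import Data.List.Membership.Propositional using (_∈_)
  open import Data.List.Membership.Propositional.Properties using (∈-++⁺ˡ; ∈-++⁺ʳ; ∈-++⁻; ∈-map⁺; ∈-map⁻)
  open import Data.List.Membership.Propositional.Properties.WithK using (unique∧set⇒bag)
  open import Data.List.Relation.Binary.BagAndSetEquality using (∼bag⇒↭)
  open import Data.List.Relation.Binary.Permutation.Propositional.Properties using (↭-length)
  open import Relation.Binary.PropositionalEquality using (_≡_; _≢_; refl; sym; trans; cong; cong₂)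
  open import Function.Base using (_∘′_)
  open import Function.Bundles using (_⇔_; mk⇔; Equivalence)

  open Equivalence using (to; from)

  module _ {A : Set} where

    HasCount-⊥ : HasCount {A} (λ _ → ⊥) 0
    HasCount-⊥ = [] , [] , (λ _ → mk⇔ (λ ()) ⊥-elim) , refl

    HasCount-≡ : (a : A) → HasCount (_≡ a) 1
    HasCount-≡ a = [ a ] , [] ∷ [] , (λ _ → mk⇔ (λ { (here e) → e ; (there ()) }) (λ e → here e)) , refl

    HasCount-⇔ : ∀ {P Q : A → Set} {c} → HasCount P c →
                 (∀ x → P x → Q x) → (∀ x → Q x → P x) → HasCount Q c
    HasCount-⇔ (L , u , mem , len) P⇒Q Q⇒P =
      L , u , (λ x → mk⇔ (P⇒Q x ∘′ to (mem x)) (from (mem x) ∘′ Q⇒P x)) , len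

    HasCount-⊎ : ∀ {P Q : A → Set} {c₁ c₂} → HasCount P c₁ → HasCount Q c₂ →
                 (∀ x → P x → Q x → ⊥) → HasCount (λ x → P x ⊎ Q x) (c₁ + c₂)
    HasCount-⊎ {P} {Q} (L₁ , u₁ , mem₁ , len₁) (L₂ , u₂ , mem₂ , len₂) disjoint =
      L₁ ++ L₂ ,
      Unique.++⁺ u₁ u₂ (λ (i₁ , i₂) → disjoint _ (to (mem₁ _) i₁) (to (mem₂ _) i₂)) ,
      (λ x → mk⇔ (to′ x) (from′ x)) ,
      trans (length-++ L₁) (cong₂ _+_ len₁ len₂)
      where
      to′ : ∀ x → x ∈ L₁ ++ L₂ → P x ⊎ Q x
      to′ x i with ∈-++⁻ L₁ i
      ... | inj₁ i₁ = inj₁ (to (mem₁ x) i₁)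
      ... | inj₂ i₂ = inj₂ (to (mem₂ x) i₂)
      from′ : ∀ x → P x ⊎ Q x → x ∈ L₁ ++ L₂
      from′ x (inj₁ px) = ∈-++⁺ˡ (from (mem₁ x) px)
      from′ x (inj₂ qx) = ∈-++⁺ʳ L₁ (from (mem₂ x) qx)

    HasCount-unique : ∀ {P : A → Set} {c c′} → HasCount P c → HasCount P c′ → c ≡ c′
    HasCount-unique (L , u , mem , len) (L′ , u′ , mem′ , len′) =
      trans (sym len) (trans (↭-length (∼bag⇒↭ (unique∧set⇒bag u u′ same))) len′)
      where
      same : ∀ {x} → x ∈ L ⇔ x ∈ L′
      same {x} = mk⇔ (from (mem′ x) ∘′ to (mem x)) (from (mem x) ∘′ to (mem′ x))

  module _ {A B : Set} where

    map⁺-Unique : ∀ (h : A → B) {L : List A} →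
                  (∀ {x y} → x ∈ L → y ∈ L → h x ≡ h y → x ≡ y) → Unique L → Unique (map h L)
    map⁺-Unique h {[]}    inj []         = []
    map⁺-Unique h {x ∷ L} inj (x∉ ∷ u) =
      All.tabulate hx∉ ∷ map⁺-Unique h (λ i j → inj (there i) (there j)) u
      where
      hx∉ : ∀ {z} → z ∈ map h L → h x ≢ z
      hx∉ z∈ hx≡z with ∈-map⁻ h z∈
      ... | y , y∈ , refl = All.lookup x∉ y∈ (inj (here refl) (there y∈) hx≡z)

    HasCount-image : ∀ {P : A → Set} {c} → HasCount P c → (h : A → B) →
                     (∀ {x y} → P x → P y → h x ≡ h y → x ≡ y) →
                     HasCount (λ z → ∃ λ x → P x × z ≡ h x) c
    HasCount-image {P} (L , u , mem , len) h inj =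
      map h L ,
      map⁺-Unique h (λ i j → inj (to (mem _) i) (to (mem _) j)) u ,
      (λ z → mk⇔ (to′ z) (from′ z)) ,
      trans (length-map h L) len
      where
      to′ : ∀ z → z ∈ map h L → ∃ λ x → P x × z ≡ h x
      to′ z i with ∈-map⁻ h i
      ... | x , x∈ , e = x , to (mem x) x∈ , e
      from′ : ∀ z → (∃ λ x → P x × z ≡ h x) → z ∈ map h L
      from′ z (x , px , refl) = ∈-map⁺ h (from (mem x) px)

module DescentSequences where

  open import Data.Nat as ℕ using (ℕ; zero; suc; _+_; _*_; _∸_; _≤_; _<_; z≤n; s≤s)
  import Data.Nat.Properties as ℕ
  open import Data.Product using (∃; _×_; _,_; proj₂)
  open import Data.Sum using (_⊎_; inj₁; inj₂)
  open import Data.Empty using (⊥-elim)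
  open import Data.Unit using (⊤; tt)
  open import Data.List using (List; []; _∷_; _++_; length; replicate)
  open import Data.Nat.ListAction using (sum)
  open import Data.List.Properties using (length-++; length-replicate; ++-assoc; ∷-injectiveʳ)
  open import Data.List.Relation.Unary.All using (All; []; _∷_)
  open import Relation.Nullary using (yes; no)
  open import Relation.Binary.PropositionalEquality
    using (_≡_; _≢_; refl; sym; trans; cong; cong₂; subst; module ≡-Reasoning)

  -- U D^{d₀} U D^{d₁} ⋯ U D^{d_{n-1}}: every word starting with U is path d for a unique d
  path : List ℕ → List Step
  path []      = []
  path (x ∷ d) = U ∷ replicate x D ++ path d

  leadingDs : List Step → ℕ
  leadingDs (D ∷ w) = suc (leadingDs w)
  leadingDs _       = 0

  descents : List Step → List ℕ
  descents []      = []
  descents (U ∷ w) = leadingDs w ∷ descents w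
  descents (D ∷ w) = descents w

  leadingDs-++ : ∀ x w → leadingDs (replicate x D ++ w) ≡ x + leadingDs w
  leadingDs-++ zero    w = refl
  leadingDs-++ (suc x) w = cong suc (leadingDs-++ x w)

  descents-++ : ∀ x w → descents (replicate x D ++ w) ≡ descents w
  descents-++ zero    w = refl
  descents-++ (suc x) w = descents-++ x w

  leadingDs-path : ∀ d → leadingDs (path d) ≡ 0
  leadingDs-path []      = refl
  leadingDs-path (x ∷ d) = refl

  descents-path : ∀ d → descents (path d) ≡ d
  descents-path []      = refl
  descents-path (x ∷ d) = cong₂ _∷_
    (trans (leadingDs-++ x (path d)) (trans (cong (x +_) (leadingDs-path d)) (ℕ.+-identityʳ x)))
    (trans (descents-++ x (path d)) (descents-path d))

  path-injective : ∀ {d e} → path d ≡ path e → d ≡ e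
  path-injective {d} {e} eq = trans (sym (descents-path d)) (trans (cong descents eq) (descents-path e))

  path-descents : ∀ w → replicate (leadingDs w) D ++ path (descents w) ≡ w
  path-descents []      = refl
  path-descents (U ∷ w) = cong (U ∷_) (path-descents w)
  path-descents (D ∷ w) = cong (D ∷_) (path-descents w)

  length-path : ∀ d → length (path d) ≡ length d + sum d
  length-path []      = refl
  length-path (x ∷ d) = cong suc (begin
    length (replicate x D ++ path d)  ≡⟨ length-++ (replicate x D) ⟩
    length (replicate x D) + length (path d)
      ≡⟨ cong₂ _+_ (length-replicate x) (length-path d) ⟩
    x + (length d + sum d)            ≡⟨ ℕ.+-comm x _ ⟩
    (length d + sum d) + x            ≡⟨ ℕ.+-assoc (length d) _ _ ⟩
    length d + (sum d + x)            ≡⟨ cong (length d +_) (ℕ.+-comm (sum d) x) ⟩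
    length d + (x + sum d)            ∎)
    where open ≡-Reasoning

  Positive : List ℕ → Set
  Positive = All (1 ≤_)

  -- the shape of the descent sequence of a path avoiding DUU
  ZerosThenPositive : List ℕ → Set
  ZerosThenPositive []          = ⊤
  ZerosThenPositive (zero  ∷ d) = ZerosThenPositive d
  ZerosThenPositive (suc x ∷ d) = Positive d

  Positive⇒ZerosThenPositive : ∀ {d} → Positive d → ZerosThenPositive d
  Positive⇒ZerosThenPositive []      = tt
  Positive⇒ZerosThenPositive (px ∷ pd) with px
  ... | s≤s _ = pd

  length≤sum : ∀ {d} → Positive d → length d ≤ sum d
  length≤sum []        = z≤n
  length≤sum (px ∷ pd) = ℕ.+-mono-≤ px (length≤sum pd)

  DyckFrom-U⁻ : ∀ h {w} → DyckFrom h (U ∷ w) → DyckFrom (suc h) w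
  DyckFrom-U⁻ zero    dy = dy
  DyckFrom-U⁻ (suc h) dy = dy

  DyckFrom-U⁺ : ∀ h {w} → DyckFrom (suc h) w → DyckFrom h (U ∷ w)
  DyckFrom-U⁺ zero    dy = dy
  DyckFrom-U⁺ (suc h) dy = dy

  DyckFrom-Ds⁻ : ∀ x h {v} → DyckFrom h (replicate x D ++ v) → x ≤ h × DyckFrom (h ∸ x) v
  DyckFrom-Ds⁻ zero    h       dy = z≤n , dy
  DyckFrom-Ds⁻ (suc x) (suc h) dy with DyckFrom-Ds⁻ x h dy
  ... | x≤h , dy′ = s≤s x≤h , dy′

  DyckFrom-Ds⁺ : ∀ x h {v} → x ≤ h → DyckFrom (h ∸ x) v → DyckFrom h (replicate x D ++ v)
  DyckFrom-Ds⁺ zero    h       _         dy = dy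
  DyckFrom-Ds⁺ (suc x) (suc h) (s≤s x≤h) dy = DyckFrom-Ds⁺ x h x≤h dy

  DyckFrom⇒sum : ∀ h d → DyckFrom h (path d) → sum d ≡ h + length d
  DyckFrom⇒sum zero    []      dy = refl
  DyckFrom⇒sum (suc h) []      ()
  DyckFrom⇒sum h       (x ∷ d) dy with DyckFrom-Ds⁻ x (suc h) (DyckFrom-U⁻ h dy)
  ... | x≤ , dy′ = begin
    x + sum d                       ≡⟨ cong (x +_) (DyckFrom⇒sum (suc h ∸ x) d dy′) ⟩
    x + ((suc h ∸ x) + length d)    ≡⟨ ℕ.+-assoc x _ _ ⟨
    (x + (suc h ∸ x)) + length d    ≡⟨ cong (_+ length d) (ℕ.m+[n∸m]≡n x≤) ⟩
    suc h + length d                ≡⟨ ℕ.+-suc h (length d) ⟨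
    h + suc (length d)              ∎
    where open ≡-Reasoning

  Positive⇒DyckFrom : ∀ h d → Positive d → sum d ≡ h + length d → DyckFrom h (path d)
  Positive⇒DyckFrom zero    []      _         _ = tt
  Positive⇒DyckFrom (suc h) []      _         ()
  Positive⇒DyckFrom h       (x ∷ d) (_ ∷ pd) eq =
    DyckFrom-U⁺ h (DyckFrom-Ds⁺ x (suc h) x≤ (Positive⇒DyckFrom (suc h ∸ x) d pd eq′))
    where
    eq₁ : x + sum d ≡ suc h + length d
    eq₁ = trans eq (ℕ.+-suc h (length d))
    x≤ : x ≤ suc h
    x≤ = ℕ.+-cancelʳ-≤ (length d) x (suc h) (subst (x + length d ≤_) eq₁ (ℕ.+-monoʳ-≤ x (length≤sum pd)))
    eq′ : sum d ≡ (suc h ∸ x) + length d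
    eq′ = ℕ.+-cancelˡ-≡ x _ _ (trans eq₁ (trans (cong (_+ length d) (sym (ℕ.m+[n∸m]≡n x≤)))
                                                (ℕ.+-assoc x (suc h ∸ x) (length d))))

  ZerosThenPositive⇒DyckFrom : ∀ h d → ZerosThenPositive d → sum d ≡ h + length d → DyckFrom h (path d)
  ZerosThenPositive⇒DyckFrom h []          _  eq = Positive⇒DyckFrom h [] [] eq
  ZerosThenPositive⇒DyckFrom h (zero  ∷ d) zp eq =
    DyckFrom-U⁺ h (ZerosThenPositive⇒DyckFrom (suc h) d zp (trans eq (ℕ.+-suc h (length d))))
  ZerosThenPositive⇒DyckFrom h (suc x ∷ d) pd eq = Positive⇒DyckFrom h (suc x ∷ d) (s≤s z≤n ∷ pd) eq

  DUU : List Step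
  DUU = D ∷ U ∷ U ∷ []

  Factor-++⁺ : ∀ v {α w} → Factor α w → Factor α (v ++ w)
  Factor-++⁺ v {α} (u , r , eq) = v ++ u , r , trans (cong (v ++_) eq) (sym (++-assoc v u (α ++ r)))

  Factor-∷⁻ : ∀ {α x w} → Factor α (x ∷ w) → (∃ λ v → x ∷ w ≡ α ++ v) ⊎ Factor α w
  Factor-∷⁻ ([]    , v , eq) = inj₁ (v , eq)
  Factor-∷⁻ (_ ∷ u , v , eq) = inj₂ (u , v , ∷-injectiveʳ eq)

  replicate-+-++ : ∀ a b (w : List Step) → replicate (a + b) D ++ w ≡ replicate a D ++ replicate b D ++ w
  replicate-+-++ zero    b w = refl
  replicate-+-++ (suc a) b w = cong (D ∷_) (replicate-+-++ a b w)

  replicate-suc-++ : ∀ x (w : List Step) → replicate (suc x) D ++ w ≡ replicate x D ++ D ∷ w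
  replicate-suc-++ zero    w = refl
  replicate-suc-++ (suc x) w = cong (D ∷_) (replicate-suc-++ x w)

  Avoids-DUU⇒Positive : ∀ h d → DyckFrom h (path d) → Avoids DUU (D ∷ path d) → Positive d
  Avoids-DUU⇒Positive h []              dy av = []
  Avoids-DUU⇒Positive h (zero ∷ [])     dy av = ⊥-elim (DyckFrom-U⁻ h dy)
  Avoids-DUU⇒Positive h (zero ∷ y ∷ d)  dy av = ⊥-elim (av ([] , replicate y D ++ path d , refl))
  Avoids-DUU⇒Positive h (suc x ∷ d)     dy av =
    s≤s z≤n ∷ Avoids-DUU⇒Positive (h ∸ x) d (proj₂ (DyckFrom-Ds⁻ x h (DyckFrom-U⁻ h dy))) av′
    where
    av′ : Avoids DUU (D ∷ path d)
    av′ f = av (subst (Factor DUU) (cong (λ w → D ∷ U ∷ w) (sym (replicate-suc-++ x (path d))))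
                      (Factor-++⁺ (D ∷ U ∷ replicate x D) f))

  Avoids-DUU⇒ZerosThenPositive : ∀ h d → DyckFrom h (path d) → Avoids DUU (path d) → ZerosThenPositive d
  Avoids-DUU⇒ZerosThenPositive h []          dy av = tt
  Avoids-DUU⇒ZerosThenPositive h (zero ∷ d)  dy av =
    Avoids-DUU⇒ZerosThenPositive (suc h) d (DyckFrom-U⁻ h dy) (λ f → av (Factor-++⁺ (U ∷ []) f))
  Avoids-DUU⇒ZerosThenPositive h (suc x ∷ d) dy av =
    Avoids-DUU⇒Positive (h ∸ x) d (proj₂ (DyckFrom-Ds⁻ x h (DyckFrom-U⁻ h dy))) av′
    where
    av′ : Avoids DUU (D ∷ path d)
    av′ f = av (subst (Factor DUU) (cong (U ∷_) (sym (replicate-suc-++ x (path d))))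
                      (Factor-++⁺ (U ∷ replicate x D) f))

  mutual
    ZerosThenPositive⇒Avoids-DUU : ∀ d → ZerosThenPositive d → Avoids DUU (path d)
    ZerosThenPositive⇒Avoids-DUU []          _  ([]    , _ , ())
    ZerosThenPositive⇒Avoids-DUU []          _  (_ ∷ _ , _ , ())
    ZerosThenPositive⇒Avoids-DUU (zero ∷ d)  zp f with Factor-∷⁻ f
    ... | inj₁ (_ , ())
    ... | inj₂ f′ = Avoids-DUU-Ds 0 d (λ ()) zp f′
    ZerosThenPositive⇒Avoids-DUU (suc x ∷ d) pd f with Factor-∷⁻ f
    ... | inj₁ (_ , ())
    ... | inj₂ f′ = Avoids-DUU-Ds (suc x) d (λ _ → pd) (Positive⇒ZerosThenPositive pd) f′

    Avoids-DUU-Ds : ∀ x d → (1 ≤ x → Positive d) → ZerosThenPositive d →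
                    Avoids DUU (replicate x D ++ path d)
    Avoids-DUU-Ds zero    d pos zp f = ZerosThenPositive⇒Avoids-DUU d zp f
    Avoids-DUU-Ds (suc x) d pos zp f with Factor-∷⁻ f
    Avoids-DUU-Ds (suc (suc x)) d           pos zp f | inj₁ (_ , ())
    Avoids-DUU-Ds (suc zero)    []          pos zp f | inj₁ (_ , ())
    Avoids-DUU-Ds (suc zero)    (suc y ∷ d) pos zp f | inj₁ (_ , ())
    Avoids-DUU-Ds (suc zero)    (zero ∷ d)  pos zp f | inj₁ _ with pos (s≤s z≤n)
    ... | () ∷ _
    Avoids-DUU-Ds (suc x)       d           pos zp f | inj₂ f′ =
      Avoids-DUU-Ds x d (λ _ → pos (s≤s z≤n)) zp f′

  module _ (p : ℕ) where

    Avoids-Dᵖ⁺¹⇒bounded : ∀ d → Avoids (replicate (suc p) D) (path d) → All (_≤ p) d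
    Avoids-Dᵖ⁺¹⇒bounded []      av = []
    Avoids-Dᵖ⁺¹⇒bounded (x ∷ d) av with x ℕ.≤? p
    ... | yes x≤p = x≤p ∷ Avoids-Dᵖ⁺¹⇒bounded d (λ f → av (Factor-++⁺ (U ∷ replicate x D) f))
    ... | no  x≰p = ⊥-elim (av (U ∷ [] , replicate (x ∸ suc p) D ++ path d , cong (U ∷_) block))
      where
      block : replicate x D ++ path d ≡ replicate (suc p) D ++ replicate (x ∸ suc p) D ++ path d
      block = trans (cong (λ y → replicate y D ++ path d) (sym (ℕ.m+[n∸m]≡n (ℕ.≰⇒> x≰p))))
                    (replicate-+-++ (suc p) (x ∸ suc p) (path d))

    mutual
      bounded⇒Avoids-Dᵖ⁺¹ : ∀ d → All (_≤ p) d → Avoids (replicate (suc p) D) (path d)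
      bounded⇒Avoids-Dᵖ⁺¹ []      _ ([]    , _ , ())
      bounded⇒Avoids-Dᵖ⁺¹ []      _ (_ ∷ _ , _ , ())
      bounded⇒Avoids-Dᵖ⁺¹ (x ∷ d) (x≤p ∷ bd) f with Factor-∷⁻ f
      ... | inj₁ (_ , ())
      ... | inj₂ f′ = Avoids-Dᵖ⁺¹-Ds x d x≤p bd f′

      Avoids-Dᵖ⁺¹-Ds : ∀ x d → x ≤ p → All (_≤ p) d → Avoids (replicate (suc p) D) (replicate x D ++ path d)
      Avoids-Dᵖ⁺¹-Ds zero    d x≤p bd f = bounded⇒Avoids-Dᵖ⁺¹ d bd f
      Avoids-Dᵖ⁺¹-Ds (suc x) d x<p bd f with Factor-∷⁻ f
      ... | inj₁ (v , eq) = too-short x p d v x<p (∷-injectiveʳ eq)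
        where
        too-short : ∀ a b d v → a < b → replicate a D ++ path d ≢ replicate b D ++ v
        too-short zero    (suc b) []      v _         ()
        too-short zero    (suc b) (_ ∷ _) v _         ()
        too-short (suc a) (suc b) d       v (s≤s a<b) eq = too-short a b d v a<b (∷-injectiveʳ eq)
      ... | inj₂ f′ = Avoids-Dᵖ⁺¹-Ds x d (ℕ.<⇒≤ x<p) bd f′

  -- d is the descent sequence of a path of 𝓕ₙᵖ
  record Valid (p n : ℕ) (d : List ℕ) : Set where
    constructor valid
    field
      length≡           : length d ≡ n
      sum≡              : sum d ≡ n
      bounded           : All (_≤ p) d
      zerosThenPositive : ZerosThenPositive d

  module _ {p n : ℕ} where

    F⇒Valid : ∀ {w} → F p n w → Valid p n (descents w) × w ≡ path (descents w)
    F⇒Valid {w} ((len , dy) , avoids-DUU , avoids-Dᵖ⁺¹) =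
      valid length≡ (trans sum≡length length≡)
            (Avoids-Dᵖ⁺¹⇒bounded p d (λ f → avoids-Dᵖ⁺¹ (subst (Factor _) (sym w≡) f)))
            (Avoids-DUU⇒ZerosThenPositive 0 d dy′ (λ f → avoids-DUU (subst (Factor DUU) (sym w≡) f))) ,
      w≡
      where
      d : List ℕ
      d = descents w
      no-leading-D : ∀ w → DyckFrom 0 w → leadingDs w ≡ 0
      no-leading-D []      _ = refl
      no-leading-D (U ∷ w) _ = refl
      no-leading-D (D ∷ w) ()
      w≡ : w ≡ path d
      w≡ = sym (trans (cong (λ x → replicate x D ++ path d) (sym (no-leading-D w dy))) (path-descents w))
      dy′ : DyckFrom 0 (path d)
      dy′ = subst (DyckFrom 0) w≡ dy
      sum≡length : sum d ≡ length d
      sum≡length = DyckFrom⇒sum 0 d dy′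
      length≡ : length d ≡ n
      length≡ = ℕ.*-cancelˡ-≡ (length d) n 2 (begin
        2 * length d           ≡⟨ cong (length d +_) (ℕ.+-identityʳ (length d)) ⟩
        length d + length d    ≡⟨ cong (length d +_) sum≡length ⟨
        length d + sum d       ≡⟨ length-path d ⟨
        length (path d)        ≡⟨ cong length w≡ ⟨
        length w               ≡⟨ len ⟩
        2 * n                  ∎)
        where open ≡-Reasoning

    Valid⇒F : ∀ {d} → Valid p n d → F p n (path d)
    Valid⇒F {d} (valid length≡ sum≡ bounded ztp) =
      (len , ZerosThenPositive⇒DyckFrom 0 d ztp (trans sum≡ (sym length≡))) ,
      ZerosThenPositive⇒Avoids-DUU d ztp , bounded⇒Avoids-Dᵖ⁺¹ p d bounded
      where
      len : length (path d) ≡ 2 * n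
      len = trans (length-path d) (trans (cong₂ _+_ length≡ sum≡) (cong (n +_) (sym (ℕ.+-identityʳ n))))

module StanleyOrder where

  open DescentSequences
  open import Data.Nat as ℕ using (ℕ; zero; suc; _≤_; _<_; z≤n; s≤s; _⊓_)
  open import Data.Nat.ListAction using (sum)
  import Data.Nat.Properties as ℕ
  open import Data.Integer as ℤ using (ℤ; +_; -_; _+_; +≤+)
  import Data.Integer.Properties as ℤ
  open import Data.Integer.Tactic.RingSolver using (solve-∀)
  open import Data.Product using (_×_; _,_; proj₁; proj₂)
  open import Data.List using (List; []; _∷_; _++_; length; replicate; take)
  open import Data.List.Properties using (length-take)
  open import Relation.Binary.PropositionalEquality
    using (_≡_; refl; sym; trans; cong; cong₂; subst; subst₂; module ≡-Reasoning)
  open import Function.Bundles using (_⇔_; mk⇔; Equivalence)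
  open import Relation.Nullary using (yes; no)

  #U : List Step → ℕ
  #U []      = 0
  #U (U ∷ w) = suc (#U w)
  #U (D ∷ w) = #U w

  height+length : ∀ v → heightOf v + + length v ≡ + (#U v ℕ.+ #U v)
  height+length []      = refl
  height+length (U ∷ v) = begin
    (+ 1 + heightOf v) + (+ 1 + + length v)  ≡⟨ regroup (heightOf v) (+ length v) ⟩
    + 2 + (heightOf v + + length v)          ≡⟨ cong (λ h → + 2 + h) (height+length v) ⟩
    + suc (suc (#U v ℕ.+ #U v))              ≡⟨ cong (λ m → + suc m) (ℕ.+-suc (#U v) (#U v)) ⟨
    + (suc (#U v) ℕ.+ suc (#U v))            ∎
    where
    open ≡-Reasoning
    regroup : ∀ a b → (+ 1 + a) + (+ 1 + b) ≡ + 2 + (a + b)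
    regroup = solve-∀
  height+length (D ∷ v) = trans (regroup (heightOf v) (+ length v)) (height+length v)
    where
    regroup : ∀ a b → (- + 1 + a) + (+ 1 + b) ≡ a + b
    regroup = solve-∀

  ups : List Step → ℕ → ℕ
  ups w t = #U (take t w)

  ≤S⇔ups≤ : ∀ P Q → length P ≡ length Q → P ≤S Q ⇔ (∀ t → ups P t ≤ ups Q t)
  ≤S⇔ups≤ P Q len = mk⇔
    (λ P≤Q t → half (ℤ.drop‿+≤+ (subst₂ ℤ._≤_ (height+length (take t P)) (heights t)
                                             (ℤ.+-monoˡ-≤ (+ length (take t P)) (P≤Q t)))))
    (λ ups≤ t → ℤ-+-cancelʳ-≤ (+ length (take t P))
                  (subst₂ ℤ._≤_ (sym (height+length (take t P))) (sym (heights t))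
                          (+≤+ (ℕ.+-mono-≤ (ups≤ t) (ups≤ t)))))
    where
    heights : ∀ t → hAt Q t + + length (take t P) ≡ + (ups Q t ℕ.+ ups Q t)
    heights t = trans (cong (λ l → hAt Q t + + l)
                            (trans (length-take t P) (trans (cong (t ⊓_) len) (sym (length-take t Q)))))
                      (height+length (take t Q))
    half : ∀ {a b} → a ℕ.+ a ≤ b ℕ.+ b → a ≤ b
    half a+a≤b+b = ℕ.≮⇒≥ (λ b<a → ℕ.<⇒≱ (ℕ.+-mono-< b<a b<a) a+a≤b+b)
    ℤ-+-cancelʳ-≤ : ∀ {a b} c → a + c ℤ.≤ b + c → a ℤ.≤ b
    ℤ-+-cancelʳ-≤ {a} {b} c le = subst₂ ℤ._≤_ (cancel a c) (cancel b c) (ℤ.+-monoˡ-≤ (- c) le)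
      where
      cancel : ∀ x c → x + c + - c ≡ x
      cancel = solve-∀

  -- position of the m-th up-step, counting from 0
  upPos : List Step → ℕ → ℕ
  upPos []      m       = 0
  upPos (U ∷ w) zero    = 0
  upPos (U ∷ w) (suc m) = suc (upPos w m)
  upPos (D ∷ w) m       = suc (upPos w m)

  <ups⇒ : ∀ w m t → m < ups w t → m < #U w × upPos w m < t
  <ups⇒ []      m       zero    ()
  <ups⇒ []      m       (suc t) ()
  <ups⇒ (_ ∷ w) m       zero    ()
  <ups⇒ (U ∷ w) zero    (suc t) _         = s≤s z≤n , s≤s z≤n
  <ups⇒ (U ∷ w) (suc m) (suc t) (s≤s m<) with <ups⇒ w m t m<
  ... | m<#U , pos< = s≤s m<#U , s≤s pos<
  <ups⇒ (D ∷ w) m       (suc t) m< with <ups⇒ w m t m<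
  ... | m<#U , pos< = m<#U , s≤s pos<

  <ups⇐ : ∀ w m t → m < #U w → upPos w m < t → m < ups w t
  <ups⇐ (U ∷ w) zero    (suc t) _          _          = s≤s z≤n
  <ups⇐ (U ∷ w) (suc m) (suc t) (s≤s m<#U) (s≤s pos<) = s≤s (<ups⇐ w m t m<#U pos<)
  <ups⇐ (D ∷ w) m       (suc t) m<#U       (s≤s pos<) = <ups⇐ w m t m<#U pos<

  ups≤⇒upPos≥ : ∀ P Q → (∀ t → ups P t ≤ ups Q t) → ∀ m → m < #U P → upPos Q m ≤ upPos P m
  ups≤⇒upPos≥ P Q ups≤ m m<#U = ℕ.≤-pred (proj₂ (<ups⇒ Q m (suc t)
    (ℕ.<-≤-trans (<ups⇐ P m (suc t) m<#U ℕ.≤-refl) (ups≤ (suc t)))))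
    where
    t : ℕ
    t = upPos P m

  upPos≥⇒ups≤ : ∀ P Q → #U P ≡ #U Q → (∀ m → m < #U P → upPos Q m ≤ upPos P m) →
                ∀ t → ups P t ≤ ups Q t
  upPos≥⇒ups≤ P Q #U≡ upPos≥ t with ups P t in eq
  ... | zero  = z≤n
  ... | suc m with <ups⇒ P m t (subst (m <_) (sym eq) ℕ.≤-refl)
  ...   | m<#U , pos< = <ups⇐ Q m t (subst (m <_) #U≡ m<#U) (ℕ.≤-<-trans (upPos≥ m m<#U) pos<)

  psum : List ℕ → ℕ → ℕ
  psum d       zero    = 0
  psum []      (suc i) = 0
  psum (x ∷ d) (suc i) = x ℕ.+ psum d i

  psum-saturates : ∀ d i → length d ≤ i → psum d i ≡ sum d
  psum-saturates []      zero    _         = refl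
  psum-saturates []      (suc i) _         = refl
  psum-saturates (x ∷ d) (suc i) (s≤s d≤i) = cong (x ℕ.+_) (psum-saturates d i d≤i)

  #U-path : ∀ d → #U (path d) ≡ length d
  #U-path []      = refl
  #U-path (x ∷ d) = cong suc (trans (#U-Ds x) (#U-path d))
    where
    #U-Ds : ∀ x → #U (replicate x D ++ path d) ≡ #U (path d)
    #U-Ds zero    = refl
    #U-Ds (suc x) = #U-Ds x

  upPos-path : ∀ d m → m < length d → upPos (path d) m ≡ m ℕ.+ psum d m
  upPos-path (x ∷ d) zero    _         = refl
  upPos-path (x ∷ d) (suc m) (s≤s m<d) = cong suc (begin
    upPos (replicate x D ++ path d) m   ≡⟨ upPos-Ds x ⟩
    x ℕ.+ upPos (path d) m              ≡⟨ cong (x ℕ.+_) (upPos-path d m m<d) ⟩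
    x ℕ.+ (m ℕ.+ psum d m)              ≡⟨ ℕ.+-assoc x m _ ⟨
    (x ℕ.+ m) ℕ.+ psum d m              ≡⟨ cong (ℕ._+ psum d m) (ℕ.+-comm x m) ⟩
    (m ℕ.+ x) ℕ.+ psum d m              ≡⟨ ℕ.+-assoc m x _ ⟩
    m ℕ.+ (x ℕ.+ psum d m)              ∎)
    where
    open ≡-Reasoning
    upPos-Ds : ∀ x → upPos (replicate x D ++ path d) m ≡ x ℕ.+ upPos (path d) m
    upPos-Ds zero    = refl
    upPos-Ds (suc x) = cong suc (upPos-Ds x)

  -- path d lies weakly below path e
  infix 4 _≼_
  _≼_ : List ℕ → List ℕ → Set
  d ≼ e = ∀ i → psum e i ≤ psum d i

  module _ {d e : List ℕ} (length≡ : length d ≡ length e) (sum≡ : sum d ≡ sum e) where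

    private
      #U≡ : #U (path d) ≡ #U (path e)
      #U≡ = trans (#U-path d) (trans length≡ (sym (#U-path e)))
      length-path≡ : length (path d) ≡ length (path e)
      length-path≡ = trans (length-path d) (trans (cong₂ ℕ._+_ length≡ sum≡) (sym (length-path e)))

    ≤S⇒≼ : path d ≤S path e → d ≼ e
    ≤S⇒≼ d≤e i with i ℕ.<? length d
    ... | yes i<d = ℕ.+-cancelˡ-≤ i _ _
      (subst₂ _≤_ (upPos-path e i (subst (i <_) length≡ i<d)) (upPos-path d i i<d)
        (ups≤⇒upPos≥ (path d) (path e) (Equivalence.to (≤S⇔ups≤ _ _ length-path≡) d≤e) i
                     (subst (i <_) (sym (#U-path d)) i<d)))
    ... | no  i≮d = ℕ.≤-reflexive (trans (psum-saturates e i (subst (_≤ i) length≡ (ℕ.≮⇒≥ i≮d)))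
                                         (trans (sym sum≡) (sym (psum-saturates d i (ℕ.≮⇒≥ i≮d)))))

    ≼⇒≤S : d ≼ e → path d ≤S path e
    ≼⇒≤S d≼e = Equivalence.from (≤S⇔ups≤ _ _ length-path≡) (upPos≥⇒ups≤ (path d) (path e) #U≡ upPos≥)
      where
      upPos≥ : ∀ m → m < #U (path d) → upPos (path e) m ≤ upPos (path d) m
      upPos≥ m m< = subst₂ _≤_ (sym (upPos-path e m (subst (m <_) length≡ m<d))) (sym (upPos-path d m m<d))
                              (ℕ.+-monoʳ-≤ m (d≼e m))
        where m<d = subst (m <_) (#U-path d) m<

  psum-injective : ∀ d e → length d ≡ length e → (∀ i → psum d i ≡ psum e i) → d ≡ e
  psum-injective []      []      _       _     = refl
  psum-injective (x ∷ d) (y ∷ e) length≡ psum≡ = cong₂ _∷_ x≡y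
    (psum-injective d e (ℕ.suc-injective length≡)
      (λ i → ℕ.+-cancelˡ-≡ x _ _ (trans (psum≡ (suc i)) (cong (ℕ._+ psum e i) (sym x≡y)))))
    where
    x≡y : x ≡ y
    x≡y = trans (sym (ℕ.+-identityʳ x)) (trans (psum≡ 1) (ℕ.+-identityʳ y))

  module _ {p n : ℕ} {d e : List ℕ} (vd : Valid p n d) (ve : Valid p n e) where

    private
      length≡ : length d ≡ length e
      length≡ = trans (Valid.length≡ vd) (sym (Valid.length≡ ve))
      sum≡ : sum d ≡ sum e
      sum≡ = trans (Valid.sum≡ vd) (sym (Valid.sum≡ ve))

    valid-≤S⇒≼ : path d ≤S path e → d ≼ e
    valid-≤S⇒≼ = ≤S⇒≼ length≡ sum≡

    valid-≼⇒≤S : d ≼ e → path d ≤S path e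
    valid-≼⇒≤S = ≼⇒≤S length≡ sum≡

module BooleanIntervals where

  open import Data.Nat as ℕ using (ℕ; zero; suc; _+_; _<_; s≤s)
  import Data.Nat.Properties as ℕ
  import Data.Integer.Properties as ℤ
  open import Data.Product using (_,_; proj₁; proj₂)
  open import Data.Sum using (_⊎_; inj₁; inj₂)
  open import Data.Vec as Vec using (_∷_; []; here)
  open import Data.Fin.Subset as Subset using (Subset; _⊆_; inside; outside)
  import Data.Fin.Subset.Properties as Subset
  open import Data.List using (List)
  open import Relation.Binary.PropositionalEquality
    using (_≡_; _≢_; refl; sym; trans; cong; subst; subst₂)
  open import Function.Bundles using (_⇔_; Equivalence)
  open import Function.Base using (_∘_)

  ≤S-refl : ∀ {P} → P ≤S P
  ≤S-refl i = ℤ.≤-refl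

  ≤S-trans : ∀ {P Q R} → P ≤S Q → Q ≤S R → P ≤S R
  ≤S-trans P≤Q Q≤R i = ℤ.≤-trans (P≤Q i) (Q≤R i)

  initial : ∀ m → ℕ → Subset m
  initial zero    j       = []
  initial (suc m) zero    = outside ∷ initial m zero
  initial (suc m) (suc j) = inside ∷ initial m j

  initial-zero : ∀ m → initial m 0 ≡ Subset.⊥
  initial-zero zero    = refl
  initial-zero (suc m) = cong (outside ∷_) (initial-zero m)

  initial-all : ∀ m → initial m m ≡ Subset.⊤
  initial-all zero    = refl
  initial-all (suc m) = cong (inside ∷_) (initial-all m)

  initial-⊆ : ∀ m j → initial m j ⊆ initial m (suc j)
  initial-⊆ (suc m) zero    = Subset.out⊆ Subset.⊆-refl
  initial-⊆ (suc m) (suc j) = Subset.s⊆s (initial-⊆ m j)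

  initial-≢ : ∀ m j → j < m → initial m j ≢ initial m (suc j)
  initial-≢ (suc m) zero    _         ()
  initial-≢ (suc m) (suc j) (s≤s j<m) eq = initial-≢ m j j<m (cong Vec.tail eq)

  initial-cover : ∀ m j {S} → initial m j ⊆ S → S ⊆ initial m (suc j) → S ≡ initial m j ⊎ S ≡ initial m (suc j)
  initial-cover zero    j       {[]}    _  _  = inj₁ refl
  initial-cover (suc m) zero    {b ∷ S} lo hi with Subset.⊆-antisym (Subset.drop-∷-⊆ hi) (Subset.drop-∷-⊆ lo)
  initial-cover (suc m) zero    {outside ∷ S} lo hi | refl = inj₁ refl
  initial-cover (suc m) zero    {inside  ∷ S} lo hi | refl = inj₂ refl
  initial-cover (suc m) (suc j) {b ∷ S} lo hi with lo here
  ... | here with initial-cover m j (Subset.drop-∷-⊆ lo) (Subset.drop-∷-⊆ hi)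
  ...   | inj₁ refl = inj₁ refl
  ...   | inj₂ refl = inj₂ refl

  module IsomorphicInterval {p n P Q m} (fP : F p n P) (fQ : F p n Q) (P≤Q : P ≤S Q)
    (f : (R : List Step) → InInterval p n P Q R → Subset m)
    (g : Subset m → List Step)
    (g-in : (S : Subset m) → InInterval p n P Q (g S))
    (g∘f : ∀ R (r : InInterval p n P Q R) → g (f R r) ≡ R)
    (f∘g : ∀ S → f (g S) (g-in S) ≡ S)
    (f-order : ∀ R R′ (r : InInterval p n P Q R) (r′ : InInterval p n P Q R′) → (R ≤S R′) ⇔ (f R r ⊆ f R′ r′))
    where

    In : List Step → Set
    In = InInterval p n P Q

    f-mono : ∀ {R R′} (r : In R) (r′ : In R′) → R ≤S R′ → f R r ⊆ f R′ r′
    f-mono {R} {R′} r r′ = Equivalence.to (f-order R R′ r r′)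

    f-g : ∀ S (r : In (g S)) → f (g S) r ≡ S
    f-g S r = trans (Subset.⊆-antisym (f-mono r (g-in S) ≤S-refl) (f-mono (g-in S) r ≤S-refl)) (f∘g S)

    g-mono : ∀ {S S′} → S ⊆ S′ → g S ≤S g S′
    g-mono {S} {S′} S⊆S′ = Equivalence.from (f-order (g S) (g S′) (g-in S) (g-in S′))
      (subst₂ _⊆_ (sym (f∘g S)) (sym (f∘g S′)) S⊆S′)

    P-in : In P
    P-in = fP , ≤S-refl , P≤Q

    Q-in : In Q
    Q-in = fQ , P≤Q , ≤S-refl

    g⊥≡P : g Subset.⊥ ≡ P
    g⊥≡P = trans (cong g (Subset.⊆-antisym Subset.⊥⊆ f-P⊆⊥)) (g∘f P P-in)
      where
      f-P⊆⊥ : f P P-in ⊆ Subset.⊥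
      f-P⊆⊥ = subst (f P P-in ⊆_) (f∘g Subset.⊥) (f-mono P-in (g-in Subset.⊥) (proj₁ (proj₂ (g-in Subset.⊥))))

    g⊤≡Q : g Subset.⊤ ≡ Q
    g⊤≡Q = trans (cong g (sym (Subset.⊆-antisym Subset.⊆⊤ ⊤⊆f-Q))) (g∘f Q Q-in)
      where
      ⊤⊆f-Q : Subset.⊤ ⊆ f Q Q-in
      ⊤⊆f-Q = subst (_⊆ f Q Q-in) (f∘g Subset.⊤) (f-mono (g-in Subset.⊤) Q-in (proj₂ (proj₂ (g-in Subset.⊤))))

    g-injective : ∀ {S S′} → g S ≡ g S′ → S ≡ S′
    g-injective {S} {S′} eq = trans (sym (f∘g S)) (trans (transport eq (g-in S)) (f-g S′ _))
      where
      transport : ∀ {R R′} (R≡R′ : R ≡ R′) (r : In R) → f R r ≡ f R′ (subst In R≡R′ r)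
      transport refl r = refl

    g-covers : ∀ {S S′} → S ⊆ S′ → S ≢ S′ → (∀ {S″} → S ⊆ S″ → S″ ⊆ S′ → S″ ≡ S ⊎ S″ ≡ S′) →
               Covers p n (g S) (g S′)
    g-covers {S} {S′} S⊆S′ S≢S′ nothing-between = g-mono S⊆S′ , S≢S′ ∘ g-injective , between
      where
      between : ∀ T → F p n T → g S ≤S T → T ≤S g S′ → T ≡ g S ⊎ T ≡ g S′
      between T fT gS≤T T≤gS′ with nothing-between lo hi
        where
        T-in : In T
        T-in = fT , ≤S-trans (proj₁ (proj₂ (g-in S))) gS≤T , ≤S-trans T≤gS′ (proj₂ (proj₂ (g-in S′)))
        lo : S ⊆ f T T-in
        lo = subst (_⊆ f T T-in) (f∘g S) (f-mono (g-in S) T-in gS≤T)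
        hi : f T T-in ⊆ S′
        hi = subst (f T T-in ⊆_) (f∘g S′) (f-mono T-in (g-in S′) T≤gS′)
      ... | inj₁ fT≡S  = inj₁ (trans (sym (g∘f T _)) (cong g fT≡S))
      ... | inj₂ fT≡S′ = inj₂ (trans (sym (g∘f T _)) (cong g fT≡S′))

    -- the images of the initial segments ∅ ⊂ {0} ⊂ {0, 1} ⊂ ⋯ ⊂ Fin m
    chain-from : ∀ i j → i + j ≡ m → MaxChain p n i (g (initial m j)) (g (initial m m))
    chain-from zero    j refl = done
    chain-from (suc i) j i+j≡m =
      step (proj₁ (g-in _))
           (g-covers (initial-⊆ m j) (initial-≢ m j j<m) (initial-cover m j))
           (chain-from i (suc j) (trans (ℕ.+-suc i j) i+j≡m))
      where
      j<m : j < m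
      j<m = subst (j <_) i+j≡m (ℕ.m<n+m j (s≤s ℕ.z≤n))

    maxChain : MaxChain p n m P Q
    maxChain = subst₂ (MaxChain p n m) (trans (cong g (initial-zero m)) g⊥≡P) (trans (cong g (initial-all m)) g⊤≡Q)
                      (chain-from m 0 (ℕ.+-identityʳ m))

module ValleyFlips (p : ℕ) where

  open DescentSequences
  open StanleyOrder
  open import Data.Nat as ℕ using (ℕ; zero; suc; _+_; _∸_; _≤_; z≤n; s≤s)
  import Data.Nat.Properties as ℕ
  open import Data.Nat.ListAction using (sum)
  open import Data.Nat.Tactic.RingSolver using (solve-∀)
  open import Data.Bool as Bool using (Bool; true; false; _∧_; f≤t; b≤b)
  open import Data.Product using (_×_; _,_; proj₁; proj₂)
  open import Data.Empty using (⊥)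
  open import Data.Unit using (⊤; tt)
  open import Data.List using (List; []; _∷_; length; replicate)
  open import Data.List.Relation.Unary.All using (All; []; _∷_)
  open import Data.List.Relation.Binary.Pointwise using (Pointwise; []; _∷_)
  open import Relation.Nullary using (Dec; yes; no; does; ¬_)
  open import Relation.Nullary.Decidable using (dec-true)
  open import Relation.Binary.PropositionalEquality
    using (_≡_; refl; sym; trans; cong; cong₂; subst; module ≡-Reasoning)

  bit : Bool → ℕ
  bit false = 0
  bit true  = 1

  #marks : List Bool → ℕ
  #marks []      = 0
  #marks (b ∷ s) = bit b + #marks s

  marked : List Bool → ℕ → Bool
  marked []      _       = false
  marked (b ∷ s) zero    = b
  marked (b ∷ s) (suc i) = marked s i

  -- Marking position i turns the valley in front of the i-th up-step into a peak: the up-step moves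
  -- one step to the left, and the last down-step of block i-1 becomes the first one of block i.
  raise : List ℕ → List Bool → List ℕ
  raise []      s       = []
  raise (x ∷ d) []      = x ∷ d
  raise (x ∷ d) (m ∷ s) = (x + bit m) ∸ bit (marked s 0) ∷ raise d s

  isZero : ℕ → Bool
  isZero zero    = true
  isZero (suc _) = false

  flippableAfter : Bool → ℕ → Bool
  flippableAfter z zero          = false
  flippableAfter z (suc zero)    = z
  flippableAfter z (suc (suc _)) = true

  -- Moves z v d s: the valleys marked by s can be flipped together without leaving 𝓕ᵖ.  While reading
  -- block x, z records whether the previous block is empty and v whether the valley in front of
  -- the current up-step may be flipped: flipping it empties a block of length 1, which creates
  -- DUU unless the block before is empty too, and adds a down-step to x, which must stay ≤ p.
  Moves : Bool → Bool → List ℕ → List Bool → Set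
  Moves z v []      []      = ⊤
  Moves z v []      (_ ∷ _) = ⊥
  Moves z v (x ∷ d) []      = ⊥
  Moves z v (x ∷ d) (m ∷ s) = (m ≡ true → v ≡ true × suc x ≤ p) × Moves (isZero x) (flippableAfter z x) d s

  -- moves of the path d itself, whose first up-step has no valley in front of it
  Moves₀ : List ℕ → List Bool → Set
  Moves₀ = Moves true false

  Moves-length : ∀ {z v} d s → Moves z v d s → length s ≡ length d
  Moves-length []      []      _       = refl
  Moves-length (x ∷ d) (m ∷ s) (_ , ms) = cong suc (Moves-length d s ms)

  Moves-none : ∀ z v d → Moves z v d (replicate (length d) false)
  Moves-none z v []      = tt
  Moves-none z v (x ∷ d) = (λ ()) , Moves-none _ _ d

  Moves-head : ∀ {z v} d s → Moves z v d s → marked s 0 ≡ true → v ≡ true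
  Moves-head (x ∷ d) (true ∷ s) (ok , _) _ = proj₁ (ok refl)

  Moves-head-false : ∀ {z} d s → Moves z false d s → marked s 0 ≡ false
  Moves-head-false d s ms with marked s 0 in eq
  ... | false = refl
  ... | true with Moves-head d s ms eq
  ...   | ()

  _⊆ᵐ_ : List Bool → List Bool → Set
  _⊆ᵐ_ = Pointwise Bool._≤_

  Moves-⊆ : ∀ {z v} d {s s′} → Moves z v d s → s′ ⊆ᵐ s → Moves z v d s′
  Moves-⊆ []      {[]}    _         []          = tt
  Moves-⊆ (x ∷ d) {m ∷ s} (ok , ms) (m′≤m ∷ s′⊆s) = ok ∘ upward m′≤m , Moves-⊆ d ms s′⊆s
    where
    open import Function.Base using (_∘_)
    upward : ∀ {a b} → a Bool.≤ b → a ≡ true → b ≡ true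
    upward b≤b refl = refl

  marked-⊆ : ∀ {s′ s} → s′ ⊆ᵐ s → ∀ i → marked s′ i ≡ true → marked s i ≡ true
  marked-⊆ (b≤b ∷ _)     zero    eq = eq
  marked-⊆ (_   ∷ s′⊆s) (suc i) eq = marked-⊆ s′⊆s i eq

  bit-mono : ∀ {a b} → (a ≡ true → b ≡ true) → bit a ≤ bit b
  bit-mono {false}      _   = z≤n
  bit-mono {true}  a⇒b with a⇒b refl
  ... | refl = ℕ.≤-refl

  marked-beyond : ∀ s i → length s ≤ i → marked s i ≡ false
  marked-beyond []      i       _         = refl
  marked-beyond (b ∷ s) (suc i) (s≤s s≤i) = marked-beyond s i s≤i

  length-raise : ∀ d s → length (raise d s) ≡ length d
  length-raise []      s       = refl
  length-raise (x ∷ d) []      = refl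
  length-raise (x ∷ d) (m ∷ s) = cong suc (length-raise d s)

  flippableAfter⇒positive : ∀ z x → flippableAfter z x ≡ true → 1 ≤ x
  flippableAfter⇒positive z (suc x) _ = s≤s z≤n

  flippableAfter-false⇒2≤ : ∀ x → flippableAfter false x ≡ true → 2 ≤ x
  flippableAfter-false⇒2≤ (suc (suc x)) _ = s≤s (s≤s z≤n)

  next-move≤ : ∀ z x m d s → Moves (isZero x) (flippableAfter z x) d s → bit (marked s 0) ≤ x + bit m
  next-move≤ z x m d s ms with marked s 0 in eq
  ... | false = z≤n
  ... | true  = ℕ.≤-trans (flippableAfter⇒positive z x (Moves-head d s ms eq)) (ℕ.m≤m+n x (bit m))

  psum-raise′ : ∀ {z v} d s → Moves z v d s → ∀ i →
                psum (raise d s) i + bit (marked s i) ≡ psum d i + bit (marked s 0)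
  psum-raise′ d       s       ms       zero    = refl
  psum-raise′ []      []      _        (suc i) = refl
  psum-raise′ {z} (x ∷ d) (m ∷ s) (_ , ms) (suc i) = begin
    (x + bit m) ∸ h + psum (raise d s) i + bit (marked s i)
      ≡⟨ ℕ.+-assoc ((x + bit m) ∸ h) _ _ ⟩
    (x + bit m) ∸ h + (psum (raise d s) i + bit (marked s i))
      ≡⟨ cong ((x + bit m) ∸ h +_) (psum-raise′ d s ms i) ⟩
    (x + bit m) ∸ h + (psum d i + h)
      ≡⟨ swap ((x + bit m) ∸ h) (psum d i) h ⟩
    (x + bit m) ∸ h + h + psum d i
      ≡⟨ cong (_+ psum d i) (ℕ.m∸n+n≡m (next-move≤ z x m d s ms)) ⟩
    x + bit m + psum d i
      ≡⟨ swap′ x (bit m) (psum d i) ⟩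
    x + psum d i + bit m ∎
    where
    open ≡-Reasoning
    h : ℕ
    h = bit (marked s 0)
    swap : ∀ a b c → a + (b + c) ≡ a + c + b
    swap = solve-∀
    swap′ : ∀ a b c → a + b + c ≡ a + c + b
    swap′ = solve-∀

  psum-raise : ∀ d s → Moves₀ d s → ∀ i → psum (raise d s) i + bit (marked s i) ≡ psum d i
  psum-raise d s ms i = begin
    psum (raise d s) i + bit (marked s i)   ≡⟨ psum-raise′ d s ms i ⟩
    psum d i + bit (marked s 0)             ≡⟨ cong (λ b → psum d i + bit b) (Moves-head-false d s ms) ⟩
    psum d i + 0                            ≡⟨ ℕ.+-identityʳ _ ⟩
    psum d i                                ∎
    where open ≡-Reasoning

  sum-raise : ∀ d s → Moves₀ d s → sum (raise d s) ≡ sum d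
  sum-raise d s ms = begin
    sum (raise d s)
      ≡⟨ psum-saturates (raise d s) (length d) (ℕ.≤-reflexive (length-raise d s)) ⟨
    psum (raise d s) (length d)
      ≡⟨ ℕ.+-identityʳ _ ⟨
    psum (raise d s) (length d) + 0
      ≡⟨ cong (λ b → psum (raise d s) (length d) + bit b)
              (marked-beyond s (length d) (ℕ.≤-reflexive (Moves-length d s ms))) ⟨
    psum (raise d s) (length d) + bit (marked s (length d))
      ≡⟨ psum-raise d s ms (length d) ⟩
    psum d (length d)
      ≡⟨ psum-saturates d (length d) ℕ.≤-refl ⟩
    sum d ∎
    where open ≡-Reasoning

  raise-bounded : ∀ {z v} d s → Moves z v d s → All (_≤ p) d → All (_≤ p) (raise d s)
  raise-bounded []      []      _         _          = []
  raise-bounded (x ∷ d) (m ∷ s) (ok , ms) (x≤p ∷ bd) =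
    ℕ.≤-trans (ℕ.m∸n≤m (x + bit m) (bit (marked s 0))) (x+m≤p m ok) ∷ raise-bounded d s ms bd
    where
    x+m≤p : ∀ {v} m → (m ≡ true → v ≡ true × suc x ≤ p) → x + bit m ≤ p
    x+m≤p true  ok = subst (_≤ p) (ℕ.+-comm 1 x) (proj₂ (ok refl))
    x+m≤p false _  = subst (_≤ p) (sym (ℕ.+-identityʳ x)) x≤p

  raise-positive : ∀ {v} d s → Moves false v d s → Positive d → Positive (raise d s)
  raise-positive []          []      _         _          = []
  raise-positive (suc x ∷ d) (m ∷ s) (_ , ms) (_ ∷ pd) = head-positive ∷ raise-positive d s ms pd
    where
    head-positive : 1 ≤ (suc x + bit m) ∸ bit (marked s 0)
    head-positive with marked s 0 in eq
    ... | false = s≤s z≤n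
    ... | true with flippableAfter-false⇒2≤ (suc x) (Moves-head d s ms eq)
    ...   | s≤s (s≤s _) = ℕ.≤-trans (s≤s z≤n) (ℕ.m≤m+n _ (bit m))

  raise-zerosThenPositive : ∀ d s → Moves₀ d s → ZerosThenPositive d → ZerosThenPositive (raise d s)
  raise-zerosThenPositive []          []      _         _  = tt
  raise-zerosThenPositive (zero ∷ d)  (true ∷ s) (ok , _) _ with proj₁ (ok refl)
  ... | ()
  raise-zerosThenPositive (zero ∷ d)  (false ∷ s) (_ , ms) zp with marked s 0 in eq
  ... | false = raise-zerosThenPositive d s ms zp
  ... | true with Moves-head d s ms eq
  ...   | ()
  raise-zerosThenPositive (suc x ∷ d) (true ∷ s) (ok , _) _ with proj₁ (ok refl)
  ... | ()
  raise-zerosThenPositive (suc x ∷ d) (false ∷ s) (_ , ms) pd =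
    Positive⇒head {(suc x + 0) ∸ bit (marked s 0)} (raise-positive d s ms pd)
    where
    Positive⇒head : ∀ {y} {d′} → Positive d′ → ZerosThenPositive (y ∷ d′)
    Positive⇒head {zero}  pd′ = Positive⇒ZerosThenPositive pd′
    Positive⇒head {suc _} pd′ = pd′

  raise-valid : ∀ {n d s} → Valid p n d → Moves₀ d s → Valid p n (raise d s)
  raise-valid {d = d} {s} (valid length≡ sum≡ bounded ztp) ms =
    valid (trans (length-raise d s) length≡) (trans (sum-raise d s ms) sum≡)
          (raise-bounded d s ms bounded) (raise-zerosThenPositive d s ms ztp)

  raise-above : ∀ d s → Moves₀ d s → d ≼ raise d s
  raise-above d s ms i = ℕ.≤-trans (ℕ.m≤m+n _ _) (ℕ.≤-reflexive (psum-raise d s ms i))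

  raise-mono : ∀ d {s s′} → Moves₀ d s → s′ ⊆ᵐ s → raise d s′ ≼ raise d s
  raise-mono d {s} {s′} ms s′⊆s i = ℕ.+-cancelʳ-≤ (bit (marked s′ i)) _ _ (begin
    psum (raise d s) i + bit (marked s′ i)   ≤⟨ ℕ.+-monoʳ-≤ _ (bit-mono (marked-⊆ s′⊆s i)) ⟩
    psum (raise d s) i + bit (marked s i)    ≡⟨ psum-raise d s ms i ⟩
    psum d i                                 ≡⟨ psum-raise d s′ (Moves-⊆ d ms s′⊆s) i ⟨
    psum (raise d s′) i + bit (marked s′ i)  ∎)
    where open ℕ.≤-Reasoning

  does-true⇒ : ∀ {A : Set} (a? : Dec A) → does a? ≡ true → A
  does-true⇒ (yes a) _ = a

  does-false⇒ : ∀ {A : Set} (a? : Dec A) → does a? ≡ false → ¬ A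
  does-false⇒ (no ¬a) _ = ¬a

  allowedMoves : Bool → Bool → List ℕ → (ℕ → Bool) → List Bool
  allowedMoves z v []      c = []
  allowedMoves z v (x ∷ d) c =
    v ∧ does (suc x ℕ.≤? p) ∧ c 0 ∷ allowedMoves (isZero x) (flippableAfter z x) d (λ i → c (suc i))

  private
    ∧-true⁻ : ∀ a b c → a ∧ b ∧ c ≡ true → a ≡ true × b ≡ true × c ≡ true
    ∧-true⁻ true true true _ = refl , refl , refl

    false≤ : ∀ b → false Bool.≤ b
    false≤ false = b≤b
    false≤ true  = f≤t

  Moves-allowed : ∀ z v d c → Moves z v d (allowedMoves z v d c)
  Moves-allowed z v []      c = tt
  Moves-allowed z v (x ∷ d) c = ok , Moves-allowed _ _ d _
    where
    ok : v ∧ does (suc x ℕ.≤? p) ∧ c 0 ≡ true → v ≡ true × suc x ≤ p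
    ok eq with ∧-true⁻ v _ _ eq
    ... | v≡true , x<p , _ = v≡true , does-true⇒ (suc x ℕ.≤? p) x<p

  allowed-selected : ∀ z v d c i → marked (allowedMoves z v d c) i ≡ true → c i ≡ true
  allowed-selected z v (x ∷ d) c zero    eq = proj₂ (proj₂ (∧-true⁻ v _ _ eq))
  allowed-selected z v (x ∷ d) c (suc i) eq = allowed-selected _ _ d _ i eq

  allowed-maximal : ∀ z v d {s} c → Moves z v d s → (∀ i → marked s i ≡ true → c i ≡ true) →
                    s ⊆ᵐ allowedMoves z v d c
  allowed-maximal z v []      {[]}    c _         _        = []
  allowed-maximal z v (x ∷ d) {m ∷ s} c (ok , ms) selected =
    here m ok (selected 0) ∷ allowed-maximal _ _ d _ ms (λ i → selected (suc i))
    where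
    here : ∀ m → (m ≡ true → v ≡ true × suc x ≤ p) → (m ≡ true → c 0 ≡ true) →
           m Bool.≤ v ∧ does (suc x ℕ.≤? p) ∧ c 0
    here false _  _   = false≤ _
    here true  ok c₀ with ok refl | c₀ refl
    ... | refl , x<p | c₀≡true rewrite dec-true (suc x ℕ.≤? p) x<p | c₀≡true = b≤b

  restrict : List Bool → (ℕ → Bool) → List Bool
  restrict []      c = []
  restrict (m ∷ s) c = m ∧ c 0 ∷ restrict s (λ i → c (suc i))

  marked-restrict : ∀ s c i → marked (restrict s c) i ≡ marked s i ∧ c i
  marked-restrict []      c i       = refl
  marked-restrict (m ∷ s) c zero    = refl
  marked-restrict (m ∷ s) c (suc i) = marked-restrict s (λ j → c (suc j)) i

  restrict-⊆ : ∀ s c → restrict s c ⊆ᵐ s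
  restrict-⊆ []      c = []
  restrict-⊆ (m ∷ s) c = ∧-≤ m (c 0) ∷ restrict-⊆ s (λ i → c (suc i))
    where
    ∧-≤ : ∀ a b → a ∧ b Bool.≤ a
    ∧-≤ false b = b≤b
    ∧-≤ true  b = ≤-true b
      where
      ≤-true : ∀ b → b Bool.≤ true
      ≤-true false = f≤t
      ≤-true true  = b≤b

  raise-injective : ∀ d {s s′} → Moves₀ d s → Moves₀ d s′ → raise d s ≡ raise d s′ → s ≡ s′
  raise-injective d {s} {s′} ms ms′ eq =
    marked-injective s s′ (trans (Moves-length d s ms) (sym (Moves-length d s′ ms′))) λ i →
      bit-injective (ℕ.+-cancelˡ-≡ (psum (raise d s) i) _ _ (begin
        psum (raise d s) i + bit (marked s i)    ≡⟨ psum-raise d s ms i ⟩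
        psum d i                                 ≡⟨ psum-raise d s′ ms′ i ⟨
        psum (raise d s′) i + bit (marked s′ i)  ≡⟨ cong (λ r → psum r i + bit (marked s′ i)) eq ⟨
        psum (raise d s) i + bit (marked s′ i)   ∎))
    where
    open ≡-Reasoning
    bit-injective : ∀ {a b} → bit a ≡ bit b → a ≡ b
    bit-injective {false} {false} _ = refl
    bit-injective {true}  {true}  _ = refl
    marked-injective : ∀ s s′ → length s ≡ length s′ → (∀ i → marked s i ≡ marked s′ i) → s ≡ s′
    marked-injective []      []        _       _ = refl
    marked-injective (b ∷ s) (b′ ∷ s′) length≡ marked≡ =
      cong₂ _∷_ (marked≡ 0) (marked-injective s s′ (ℕ.suc-injective length≡) (λ i → marked≡ (suc i)))

module Completeness (p : ℕ) (2≤p : 2 ≤ p) where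

  open DescentSequences
  open StanleyOrder
  open ValleyFlips p
  open BooleanIntervals
  open import Data.Nat as ℕ using (zero; suc; _+_; _∸_; _<_; z≤n; s≤s)
  import Data.Nat.Properties as ℕ
  open import Data.Nat.ListAction using (sum)
  open import Data.Fin using (Fin; toℕ)
  open import Data.Fin.Subset as Subset using (Subset; ⁅_⁆; _∈_; _∉_; _⊆_)
  import Data.Fin.Subset.Properties as Subset
  open import Function.Bundles using (_⇔_)
  open import Algebra.Properties.CommutativeMonoid.Sum ℕ.+-0-commutativeMonoid
    using (sum-syntax; ∑-distrib-+; sum-cong-≗)
  open import Data.Bool as Bool using (Bool; true; false)
  open import Data.Product using (Σ; _×_; _,_; proj₁; proj₂)
  open import Data.Sum using (inj₁; inj₂)
  open import Data.Empty using (⊥; ⊥-elim)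
  open import Data.List using (List; []; _∷_; length; replicate)
  open import Data.List.Relation.Unary.All using (All; []; _∷_)
  open import Relation.Nullary using (yes; no; does)
  open import Relation.Nullary.Decidable using (dec-true; decidable-stable)
  open import Relation.Binary.PropositionalEquality
    using (_≡_; _≢_; refl; sym; trans; cong; cong₂; subst; subst₂; module ≡-Reasoning)

  -- a single flippable valley of d whose flip keeps it weakly below e, where path e is
  -- already δ up-steps ahead of path d
  OneMoveBelow : Bool → Bool → ℕ → List ℕ → List ℕ → Set
  OneMoveBelow z v δ d e = Σ (List Bool) λ s →
    Moves z v d s × #marks s ≡ 1 × (∀ i → psum e i + bit (marked s i) ≤ δ + psum d i)

  private
    shift-≤ : ∀ y c a b → y ≤ c → y + a ≤ c + b → a ≤ (c ∸ y) + b
    shift-≤ y c a b y≤c le = ℕ.+-cancelˡ-≤ y _ _ (subst (y + a ≤_) (split y c b y≤c) le)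
      where
      split : ∀ y c b → y ≤ c → c + b ≡ y + ((c ∸ y) + b)
      split y c b y≤c = trans (cong (_+ b) (sym (ℕ.m+[n∸m]≡n y≤c))) (ℕ.+-assoc y (c ∸ y) b)

    unshift-≤ : ∀ y c a b → y ≤ c → a ≤ (c ∸ y) + b → y + a ≤ c + b
    unshift-≤ y c a b y≤c le =
      subst (y + a ≤_) (trans (sym (ℕ.+-assoc y (c ∸ y) b)) (cong (_+ b) (ℕ.m+[n∸m]≡n y≤c))) (ℕ.+-monoʳ-≤ y le)

    shift-≡ : ∀ y c a b → y ≤ c → c + b ≡ y + a → (c ∸ y) + b ≡ a
    shift-≡ y c a b y≤c eq =
      ℕ.+-cancelˡ-≡ y _ _ (trans (trans (sym (ℕ.+-assoc y (c ∸ y) b)) (cong (_+ b) (ℕ.m+[n∸m]≡n y≤c))) eq)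

    #marks-single : ∀ n → #marks (true ∷ replicate n false) ≡ 1
    #marks-single n = cong suc (none n)
      where
      none : ∀ n → #marks (replicate n false) ≡ 0
      none zero    = refl
      none (suc n) = none n

    nowhere : ∀ n i → marked (replicate n false) i ≡ false
    nowhere zero    i       = refl
    nowhere (suc n) zero    = refl
    nowhere (suc n) (suc i) = nowhere n i

  unmarked-∷ : ∀ {z v δ} x y {d e} → y ≤ δ + x →
    OneMoveBelow (isZero x) (flippableAfter z x) ((δ + x) ∸ y) d e → OneMoveBelow z v δ (x ∷ d) (y ∷ e)
  unmarked-∷ {δ = δ} x y {d} {e} y≤δ+x (s , ms , #s , below) = false ∷ s , ((λ ()) , ms) , #s , below′
    where
    below′ : ∀ i → psum (y ∷ e) i + bit (marked (false ∷ s) i) ≤ δ + psum (x ∷ d) i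
    below′ zero    = z≤n
    below′ (suc i) = subst₂ _≤_ (sym (ℕ.+-assoc y (psum e i) _)) (ℕ.+-assoc δ x (psum d i))
                            (unshift-≤ y (δ + x) _ (psum d i) y≤δ+x (below i))

  -- when e is strictly ahead, flip the first valley of d whose block can take another down-step
  move-when-ahead : ∀ z δ d e → 1 ≤ δ → δ + sum d ≡ sum e → length d ≡ length e →
    (∀ i → psum e i ≤ δ + psum d i) → All (_≤ p) d → All (_≤ p) e → OneMoveBelow z true δ d e
  move-when-ahead z δ [] [] 1≤δ sum≡ _ _ _ _ =
    ⊥-elim (ℕ.<⇒≢ 1≤δ (sym (trans (sym (ℕ.+-identityʳ δ)) sum≡)))
  move-when-ahead z δ (x ∷ d) (y ∷ e) 1≤δ sum≡ length≡ ahead (x≤p ∷ bd) (y≤p ∷ be) with suc x ℕ.≤? p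
  ... | yes x<p =
    true ∷ replicate (length d) false , ((λ _ → refl , x<p) , Moves-none _ _ d) , #marks-single (length d) , below
    where
    below : ∀ i → psum (y ∷ e) i + bit (marked (true ∷ replicate (length d) false) i) ≤ δ + psum (x ∷ d) i
    below zero    = ℕ.≤-trans 1≤δ (ℕ.m≤m+n δ 0)
    below (suc i) = subst (_≤ δ + (x + psum d i))
                          (sym (trans (cong (λ b → y + psum e i + bit b) (nowhere (length d) i)) (ℕ.+-identityʳ _)))
                          (ahead (suc i))
  ... | no  x≮p = unmarked-∷ x y y≤δ+x (subst (λ v → OneMoveBelow (isZero x) v _ d e) (sym flippable) rest)
    where
    p≤x : p ≤ x
    p≤x = ℕ.≤-pred (ℕ.≰⇒> x≮p)
    flippable : flippableAfter z x ≡ true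
    flippable with ℕ.≤-trans 2≤p p≤x
    ... | s≤s (s≤s _) = refl
    y≤δ+x : y ≤ δ + x
    y≤δ+x = ℕ.≤-trans y≤p (ℕ.≤-trans p≤x (ℕ.m≤n+m x δ))
    rest : OneMoveBelow (isZero x) true ((δ + x) ∸ y) d e
    rest = move-when-ahead (isZero x) ((δ + x) ∸ y) d e
             (ℕ.≤-trans 1≤δ (subst (δ ≤_) (sym (ℕ.+-∸-assoc δ (ℕ.≤-trans y≤p p≤x))) (ℕ.m≤m+n δ _)))
             (shift-≡ y (δ + x) (sum e) (sum d) y≤δ+x (trans (ℕ.+-assoc δ x (sum d)) sum≡))
             (ℕ.suc-injective length≡)
             (λ i → shift-≤ y (δ + x) (psum e i) (psum d i) y≤δ+x
                      (subst (y + psum e i ≤_) (sym (ℕ.+-assoc δ x (psum d i))) (ahead (suc i))))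
             bd be

  -- walk along the common prefix of d and e; at the first difference e is ahead
  move-below : ∀ z v d e → (z ≡ false → Positive e) → ZerosThenPositive e →
    length d ≡ length e → sum d ≡ sum e → (∀ i → psum e i ≤ psum d i) →
    All (_≤ p) d → All (_≤ p) e → d ≢ e → OneMoveBelow z v 0 d e
  move-below z v [] [] _ _ _ _ _ _ _ d≢e = ⊥-elim (d≢e refl)
  move-below z v (x ∷ d) (y ∷ e) z⇒pos ztp length≡ sum≡ below (_ ∷ bd) (_ ∷ be) d≢e with x ℕ.≟ y
  ... | yes refl = unmarked-∷ x x ℕ.≤-refl (subst (λ δ → OneMoveBelow (isZero x) (flippableAfter z x) δ d e) (sym (ℕ.n∸n≡0 x)) rest)
    where
    tail-positive : ∀ x {e} → ZerosThenPositive (x ∷ e) → isZero x ≡ false → Positive e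
    tail-positive (suc _) pe _ = pe
    tail-ztp : ∀ x {e} → ZerosThenPositive (x ∷ e) → ZerosThenPositive e
    tail-ztp zero    ztp = ztp
    tail-ztp (suc _) pe  = Positive⇒ZerosThenPositive pe
    rest : OneMoveBelow (isZero x) (flippableAfter z x) 0 d e
    rest = move-below (isZero x) (flippableAfter z x) d e (tail-positive x ztp) (tail-ztp x ztp)
             (ℕ.suc-injective length≡) (ℕ.+-cancelˡ-≡ x _ _ sum≡)
             (λ i → ℕ.+-cancelˡ-≤ x _ _ (below (suc i))) bd be (λ d≡e → d≢e (cong (x ∷_) d≡e))
  ... | no  x≢y = unmarked-∷ x y y≤x (subst (λ v → OneMoveBelow (isZero x) v (x ∸ y) d e) (sym (flippable z x y z⇒pos y<x)) rest)
    where
    y≤x : y ≤ x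
    y≤x = subst₂ _≤_ (ℕ.+-identityʳ y) (ℕ.+-identityʳ x) (below 1)
    y<x : y < x
    y<x = ℕ.≤∧≢⇒< y≤x (λ y≡x → x≢y (sym y≡x))
    -- a block of length 1 can only lose its down-step if the previous block is empty
    flippable : ∀ z x y → (z ≡ false → Positive (y ∷ e)) → y < x → flippableAfter z x ≡ true
    flippable z     (suc (suc x)) y       _     _        = refl
    flippable true  (suc zero)    zero    _     _        = refl
    flippable false (suc zero)    zero    z⇒pos _ with z⇒pos refl
    ... | () ∷ _
    flippable z     (suc zero)    (suc y) _     (s≤s ())
    rest : OneMoveBelow (isZero x) true (x ∸ y) d e
    rest = move-when-ahead (isZero x) (x ∸ y) d e (ℕ.m<n⇒0<n∸m y<x)
             (shift-≡ y x (sum e) (sum d) y≤x sum≡) (ℕ.suc-injective length≡)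
             (λ i → shift-≤ y x (psum e i) (psum d i) y≤x (below (suc i))) bd be

  exists-move-below : ∀ {n d e} → Valid p n d → Valid p n e → d ≼ e → d ≢ e →
    Σ (List Bool) λ s → Moves₀ d s × #marks s ≡ 1 × raise d s ≼ e
  exists-move-below {d = d} {e} (valid d-len d-sum d-bd _) (valid e-len e-sum e-bd e-ztp) d≼e d≢e
    with move-below true false d e (λ ()) e-ztp (trans d-len (sym e-len)) (trans d-sum (sym e-sum))
                    d≼e d-bd e-bd d≢e
  ... | s , ms , #s , below = s , ms , #s , λ i → ℕ.+-cancelʳ-≤ (bit (marked s i)) _ _
          (ℕ.≤-trans (below i) (ℕ.≤-reflexive (sym (psum-raise d s ms i))))

  potential : ℕ → List ℕ → ℕ
  potential n d = ∑[ i < n ] psum d (toℕ i)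

  #marks-∑ : ∀ s → #marks s ≡ ∑[ i < length s ] bit (marked s (toℕ i))
  #marks-∑ []      = refl
  #marks-∑ (b ∷ s) = cong (bit b +_) (#marks-∑ s)

  potential-raise : ∀ {n} d s → Moves₀ d s → length d ≡ n → potential n (raise d s) + #marks s ≡ potential n d
  potential-raise {n} d s ms refl = begin
    potential n (raise d s) + #marks s
      ≡⟨ cong (potential n (raise d s) +_) (trans (#marks-∑ s) (cong (λ l → ∑[ i < l ] bit (marked s (toℕ i)))
                                                                     (Moves-length d s ms))) ⟩
    ∑[ i < n ] psum (raise d s) (toℕ i) + ∑[ i < n ] bit (marked s (toℕ i))
      ≡⟨ ∑-distrib-+ {n} (λ i → psum (raise d s) (toℕ i)) (λ i → bit (marked s (toℕ i))) ⟨
    ∑[ i < n ] (psum (raise d s) (toℕ i) + bit (marked s (toℕ i)))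
      ≡⟨ sum-cong-≗ {n} (λ i → psum-raise d s ms (toℕ i)) ⟩
    potential n d ∎
    where open ≡-Reasoning

  raise-≢ : ∀ d s → Moves₀ d s → #marks s ≡ 1 → raise d s ≢ d
  raise-≢ d s ms #s eq = ℕ.m+1+n≢m (potential (length d) d)
    (trans (cong₂ _+_ (cong (potential (length d)) (sym eq)) (sym #s)) (potential-raise d s ms refl))

  -- a single flip of d below r lies between them, so it is r
  cover-potential : ∀ {n d r} → Valid p n d → Valid p n r → Covers p n (path d) (path r) →
                    potential n d ≡ potential n r + 1
  cover-potential {n} {d} {r} vd vr (d≤r , d≢r , nothing-between)
    with exists-move-below vd vr (valid-≤S⇒≼ vd vr d≤r) (λ d≡r → d≢r (cong path d≡r))
  ... | s , ms , #s , raised≼r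
    with nothing-between (path (raise d s)) (Valid⇒F vs) (valid-≼⇒≤S vd vs (raise-above d s ms))
                         (valid-≼⇒≤S vs vr raised≼r)
    where
    vs : Valid p n (raise d s)
    vs = raise-valid vd ms
  ... | inj₁ raised≡d = ⊥-elim (raise-≢ d s ms #s (path-injective raised≡d))
  ... | inj₂ raised≡r = begin
    potential n d                        ≡⟨ potential-raise d s ms (Valid.length≡ vd) ⟨
    potential n (raise d s) + #marks s   ≡⟨ cong₂ (λ r′ k → potential n r′ + k) (path-injective raised≡r) #s ⟩
    potential n r + 1                    ∎
    where open ≡-Reasoning

  chain-potential : ∀ {n k P Q} → F p n P → MaxChain p n k P Q →
                    potential n (descents P) ≡ potential n (descents Q) + k
  chain-potential fP done = sym (ℕ.+-identityʳ _)
  chain-potential {n} {suc k} {P} {Q} fP (step {R = R} fR P⋖R R⋯Q) = begin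
    potential n (descents P)              ≡⟨ cover-potential {n} vP vR (subst₂ (Covers p n) P≡ R≡ P⋖R) ⟩
    potential n (descents R) + 1          ≡⟨ cong (_+ 1) (chain-potential fR R⋯Q) ⟩
    potential n (descents Q) + k + 1      ≡⟨ ℕ.+-assoc (potential n (descents Q)) k 1 ⟩
    potential n (descents Q) + (k + 1)    ≡⟨ cong (potential n (descents Q) +_) (ℕ.+-comm k 1) ⟩
    potential n (descents Q) + suc k      ∎
    where
    open ≡-Reasoning
    vP : Valid p n (descents P)
    vP = proj₁ (F⇒Valid {n = n} fP)
    P≡ : P ≡ path (descents P)
    P≡ = proj₂ (F⇒Valid {n = n} fP)
    vR : Valid p n (descents R)
    vR = proj₁ (F⇒Valid {n = n} fR)
    R≡ : R ≡ path (descents R)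
    R≡ = proj₂ (F⇒Valid {n = n} fR)

  module FromIsomorphism {n k P Q} (fP : F p n P) (fQ : F p n Q) (P≤Q : P ≤S Q) {m : ℕ}
    (f : (R : List Step) → InInterval p n P Q R → Subset m)
    (g : Subset m → List Step)
    (g-in : (S : Subset m) → InInterval p n P Q (g S))
    (g∘f : ∀ R (r : InInterval p n P Q R) → g (f R r) ≡ R)
    (f∘g : ∀ S → f (g S) (g-in S) ≡ S)
    (f-order : ∀ R R′ (r : InInterval p n P Q R) (r′ : InInterval p n P Q R′) → (R ≤S R′) ⇔ (f R r ⊆ f R′ r′))
    (chain : MaxChain p n k P Q) where

    open IsomorphicInterval {n = n} fP fQ P≤Q f g g-in g∘f f∘g f-order

    d e : List ℕ
    d = descents P
    e = descents Q

    vd : Valid p n d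
    vd = proj₁ (F⇒Valid {n = n} fP)

    ve : Valid p n e
    ve = proj₁ (F⇒Valid {n = n} fQ)

    P≡ : P ≡ path d
    P≡ = proj₂ (F⇒Valid {n = n} fP)

    Q≡ : Q ≡ path e
    Q≡ = proj₂ (F⇒Valid {n = n} fQ)

    d≼e : d ≼ e
    d≼e = valid-≤S⇒≼ vd ve (subst₂ _≤S_ P≡ Q≡ P≤Q)

    in-interval : ∀ {r} → Valid p n r → d ≼ r → r ≼ e → In (path r)
    in-interval vr d≼r r≼e = Valid⇒F vr , subst (_≤S _) (sym P≡) (valid-≼⇒≤S vd vr d≼r)
                                        , subst (_ ≤S_) (sym Q≡) (valid-≼⇒≤S vr ve r≼e)

    -- every valley that can be flipped and at which Q is strictly above P
    s : List Bool
    s = allowedMoves true false d (λ i → does (psum e i ℕ.<? psum d i))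

    ms : Moves₀ d s
    ms = Moves-allowed true false d _

    top : List ℕ
    top = raise d s

    top-in : In (path top)
    top-in = in-interval (raise-valid vd ms) (raise-above d s ms) top≼e
      where
      top≼e : top ≼ e
      top≼e i with marked s i in marked-i
      ... | true  = ℕ.+-cancelʳ-≤ 1 _ _ (begin
        psum e i + 1        ≡⟨ ℕ.+-comm (psum e i) 1 ⟩
        suc (psum e i)      ≤⟨ does-true⇒ (psum e i ℕ.<? psum d i) (allowed-selected true false d _ i marked-i) ⟩
        psum d i            ≡⟨ psum-raise d s ms i ⟨
        psum top i + bit (marked s i)  ≡⟨ cong (λ b → psum top i + bit b) marked-i ⟩
        psum top i + 1      ∎)
        where open ℕ.≤-Reasoning
      ... | false = begin
        psum e i                       ≤⟨ d≼e i ⟩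
        psum d i                       ≡⟨ psum-raise d s ms i ⟨
        psum top i + bit (marked s i)  ≡⟨ cong (λ b → psum top i + bit b) marked-i ⟩
        psum top i + 0                 ≡⟨ ℕ.+-identityʳ _ ⟩
        psum top i                     ∎
        where open ℕ.≤-Reasoning

    -- an atom of the interval lies above a single flip of P, which is one of the flips in s
    module Atom (x : Fin m) where

      A : List Step
      A = g ⁅ x ⁆

      A-in : In A
      A-in = g-in ⁅ x ⁆

      a : List ℕ
      a = descents A

      va : Valid p n a
      va = proj₁ (F⇒Valid {n = n} (proj₁ A-in))

      A≡ : A ≡ path a
      A≡ = proj₂ (F⇒Valid {n = n} (proj₁ A-in))

      d≼a : d ≼ a
      d≼a = valid-≤S⇒≼ vd va (subst₂ _≤S_ P≡ A≡ (proj₁ (proj₂ A-in)))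

      a≼e : a ≼ e
      a≼e = valid-≤S⇒≼ va ve (subst₂ _≤S_ A≡ Q≡ (proj₂ (proj₂ A-in)))

      d≢a : d ≢ a
      d≢a d≡a = Subset.∉⊥ (subst (x ∈_) (g-injective (trans A≡P (sym g⊥≡P))) (Subset.x∈⁅x⁆ x))
        where
        A≡P : A ≡ P
        A≡P = trans A≡ (trans (cong path (sym d≡a)) (sym P≡))

      move : Σ (List Bool) λ s₁ → Moves₀ d s₁ × #marks s₁ ≡ 1 × raise d s₁ ≼ a
      move = exists-move-below vd va d≼a d≢a

      s₁ : List Bool
      s₁ = proj₁ move

      ms₁ : Moves₀ d s₁
      ms₁ = proj₁ (proj₂ move)

      P₁ : List Step
      P₁ = path (raise d s₁)

      P₁-in : In P₁
      P₁-in = in-interval (raise-valid vd ms₁) (raise-above d s₁ ms₁)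
                          (λ i → ℕ.≤-trans (a≼e i) (proj₂ (proj₂ (proj₂ move)) i))

      f-P₁⊆x : f P₁ P₁-in ⊆ ⁅ x ⁆
      f-P₁⊆x y∈ = subst (_ ∈_) (f∘g ⁅ x ⁆)
        (f-mono P₁-in A-in (subst (P₁ ≤S_) (sym A≡) (valid-≼⇒≤S (raise-valid vd ms₁) va (proj₂ (proj₂ (proj₂ move))))) y∈)

      x∈f-P₁ : x ∈ f P₁ P₁-in
      x∈f-P₁ = decidable-stable (x Subset.∈? f P₁ P₁-in) λ x∉ →
        raise-≢ d s₁ ms₁ (proj₁ (proj₂ (proj₂ move)))
                (path-injective (trans (sym (g∘f P₁ P₁-in)) (trans (cong g (f-P₁≡⊥ x∉)) (trans g⊥≡P P≡))))
        where
        f-P₁≡⊥ : x ∉ f P₁ P₁-in → f P₁ P₁-in ≡ Subset.⊥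
        f-P₁≡⊥ x∉ = Subset.⊆-antisym (λ {y} y∈ → ⊥-elim (x∉ (subst (_∈ f P₁ P₁-in) (Subset.x∈⁅y⁆⇒x≡y x (f-P₁⊆x y∈)) y∈)))
                                     Subset.⊥⊆

      s₁⊆s : s₁ ⊆ᵐ s
      s₁⊆s = allowed-maximal true false d _ ms₁ λ i marked-i →
        dec-true (psum e i ℕ.<? psum d i) (begin-strict
          psum e i                                 ≤⟨ a≼e i ⟩
          psum a i                                 ≤⟨ proj₂ (proj₂ (proj₂ move)) i ⟩
          psum (raise d s₁) i                      <⟨ ℕ.n<1+n _ ⟩
          suc (psum (raise d s₁) i)                ≡⟨ ℕ.+-comm 1 _ ⟩
          psum (raise d s₁) i + 1                  ≡⟨ cong (λ b → psum (raise d s₁) i + bit b) marked-i ⟨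
          psum (raise d s₁) i + bit (marked s₁ i)  ≡⟨ psum-raise d s₁ ms₁ i ⟩
          psum d i                                 ∎)
        where open ℕ.≤-Reasoning

      x∈f-top : x ∈ f (path top) top-in
      x∈f-top = f-mono P₁-in top-in (valid-≼⇒≤S (raise-valid vd ms₁) (raise-valid vd ms) (raise-mono d ms s₁⊆s)) x∈f-P₁

    Q≡top : Q ≡ path top
    Q≡top = begin
      Q                  ≡⟨ g⊤≡Q ⟨
      g Subset.⊤         ≡⟨ cong g (Subset.⊆-antisym Subset.⊆⊤ (λ {x} _ → Atom.x∈f-top x)) ⟨
      g (f _ top-in)     ≡⟨ g∘f _ top-in ⟩
      path top           ∎
      where open ≡-Reasoning

    k≡#marks : k ≡ #marks s
    k≡#marks = ℕ.+-cancelˡ-≡ (potential n top) _ _ (begin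
      potential n top + k        ≡⟨ cong (λ r → potential n r + k) (trans (cong descents Q≡top) (descents-path top)) ⟨
      potential n e + k          ≡⟨ chain-potential fP chain ⟨
      potential n d              ≡⟨ potential-raise d s ms (Valid.length≡ vd) ⟨
      potential n top + #marks s ∎)
      where open ≡-Reasoning

  complete : ∀ {n k P Q} → BoolInterval p n k (P , Q) →
    Σ (List ℕ × List Bool) λ (d , s) →
      (Valid p n d × Moves₀ d s × #marks s ≡ k) × P ≡ path d × Q ≡ path (raise d s)
  complete (fP , fQ , P≤Q , (_ , f , g , g-in , g∘f , f∘g , f-order) , chain) =
    (d , s) , (vd , ms , sym k≡#marks) , P≡ , Q≡top
    where open FromIsomorphism fP fQ P≤Q f g g-in g∘f f∘g f-order chain

module Soundness (p : ℕ) where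

  open DescentSequences
  open StanleyOrder
  open ValleyFlips p
  open BooleanIntervals
  open import Data.Nat as ℕ using (zero; suc; _+_; _≤_)
  import Data.Nat.Properties as ℕ
  open import Data.Bool as Bool using (Bool; true; false; _∧_)
  open import Data.Product using (_×_; _,_; proj₁; proj₂)
  open import Data.Vec using (_∷_; []; here; there)
  open import Data.Fin using (zero; suc)
  open import Data.Fin.Subset as Subset using (Subset; _⊆_; _∈_)
  import Data.Fin.Subset.Properties as Subset
  open import Data.List using (List; []; _∷_)
  open import Data.List.Relation.Binary.Pointwise using ([]; _∷_)
  open import Relation.Nullary using (does)
  open import Relation.Nullary.Decidable using (dec-true; dec-false)
  open import Relation.Binary.PropositionalEquality
    using (_≡_; refl; sym; trans; cong; cong₂; subst; subst₂; module ≡-Reasoning)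
  open import Function.Bundles using (_⇔_; mk⇔; Equivalence)

  -- the subsets of the marks of s, as sub-lists of s and as subsets of Fin (#marks s)
  spread : (s : List Bool) → Subset (#marks s) → List Bool
  spread []          _       = []
  spread (false ∷ s) T       = false ∷ spread s T
  spread (true  ∷ s) (b ∷ T) = b ∷ spread s T

  collect : (s : List Bool) → (ℕ → Bool) → Subset (#marks s)
  collect []          c = []
  collect (false ∷ s) c = collect s (λ i → c (suc i))
  collect (true  ∷ s) c = c 0 ∷ collect s (λ i → c (suc i))

  spread-⊆ : ∀ s T → spread s T ⊆ᵐ s
  spread-⊆ []          _       = []
  spread-⊆ (false ∷ s) T       = Bool.b≤b ∷ spread-⊆ s T
  spread-⊆ (true  ∷ s) (b ∷ T) = ≤-true b ∷ spread-⊆ s T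
    where
    ≤-true : ∀ b → b Bool.≤ true
    ≤-true false = Bool.f≤t
    ≤-true true  = Bool.b≤b

  collect-spread : ∀ s T → collect s (marked (spread s T)) ≡ T
  collect-spread []          []      = refl
  collect-spread (false ∷ s) T       = collect-spread s T
  collect-spread (true  ∷ s) (b ∷ T) = cong (b ∷_) (collect-spread s T)

  spread-collect : ∀ s c → spread s (collect s c) ≡ restrict s c
  spread-collect []          c = refl
  spread-collect (false ∷ s) c = cong (false ∷_) (spread-collect s _)
  spread-collect (true  ∷ s) c = cong (c 0 ∷_) (spread-collect s _)

  collect-cong : ∀ s {c c′} → (∀ i → c i ≡ c′ i) → collect s c ≡ collect s c′
  collect-cong []          c≡c′ = refl
  collect-cong (false ∷ s) c≡c′ = collect-cong s (λ i → c≡c′ (suc i))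
  collect-cong (true  ∷ s) c≡c′ = cong₂ _∷_ (c≡c′ 0) (collect-cong s (λ i → c≡c′ (suc i)))

  collect-⊆⇔ : ∀ s c c′ → collect s c ⊆ collect s c′ ⇔ (∀ i → marked s i ≡ true → c i ≡ true → c′ i ≡ true)
  collect-⊆⇔ s c c′ = mk⇔ (to s c c′) (from s c c′)
    where
    ∈-head : ∀ {m b} {T : Subset m} → zero ∈ b ∷ T → b ≡ true
    ∈-head here = refl
    head-∈ : ∀ {m b} {T : Subset m} → b ≡ true → zero ∈ b ∷ T
    head-∈ refl = here
    to : ∀ s c c′ → collect s c ⊆ collect s c′ → ∀ i → marked s i ≡ true → c i ≡ true → c′ i ≡ true
    to (false ∷ s) c c′ sub (suc i) mᵢ cᵢ = to s _ _ sub i mᵢ cᵢ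
    to (true  ∷ s) c c′ sub zero    _  c₀ = ∈-head (sub (head-∈ c₀))
    to (true  ∷ s) c c′ sub (suc i) mᵢ cᵢ = to s _ _ (Subset.drop-∷-⊆ sub) i mᵢ cᵢ
    from : ∀ s c c′ → (∀ i → marked s i ≡ true → c i ≡ true → c′ i ≡ true) → collect s c ⊆ collect s c′
    from (false ∷ s) c c′ h x∈         = from s _ _ (λ i → h (suc i)) x∈
    from (true  ∷ s) c c′ h {zero}  x∈ = head-∈ (h 0 refl (∈-head x∈))
    from (true  ∷ s) c c′ h {suc _} x∈ = there (from s _ _ (λ i → h (suc i)) (Subset.drop-there x∈))

  module Raised {n d s} (vd : Valid p n d) (ms : Moves₀ d s) where

    top : List ℕ
    top = raise d s

    vtop : Valid p n top
    vtop = raise-valid vd ms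

    In : List Step → Set
    In = InInterval p n (path d) (path top)

    valid-of : ∀ {R} → In R → Valid p n (descents R)
    valid-of (fR , _) = proj₁ (F⇒Valid {n = n} fR)

    path-of : ∀ {R} → In R → R ≡ path (descents R)
    path-of (fR , _) = proj₂ (F⇒Valid {n = n} fR)

    ≼-in : ∀ {R} (r : In R) → d ≼ descents R × descents R ≼ top
    ≼-in {R} r@(_ , d≤R , R≤top) =
      valid-≤S⇒≼ vd (valid-of r) (subst (path d ≤S_) (path-of r) d≤R) ,
      valid-≤S⇒≼ (valid-of r) vtop (subst (_≤S path top) (path-of r) R≤top)

    ahead : List ℕ → ℕ → Bool
    ahead r i = does (psum r i ℕ.<? psum d i)

    ahead-raise : ∀ s′ → Moves₀ d s′ → ∀ i → ahead (raise d s′) i ≡ marked s′ i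
    ahead-raise s′ ms′ i with marked s′ i in mᵢ
    ... | true  = dec-true (_ ℕ.<? _) (ℕ.≤-reflexive (begin
      suc (psum (raise d s′) i)                ≡⟨ ℕ.+-comm 1 _ ⟩
      psum (raise d s′) i + 1                  ≡⟨ cong (λ b → psum (raise d s′) i + bit b) mᵢ ⟨
      psum (raise d s′) i + bit (marked s′ i)  ≡⟨ psum-raise d s′ ms′ i ⟩
      psum d i                                 ∎))
      where open ≡-Reasoning
    ... | false = dec-false (_ ℕ.<? _) (ℕ.<-irrefl (begin
      psum (raise d s′) i                      ≡⟨ ℕ.+-identityʳ _ ⟨
      psum (raise d s′) i + 0                  ≡⟨ cong (λ b → psum (raise d s′) i + bit b) mᵢ ⟨
      psum (raise d s′) i + bit (marked s′ i)  ≡⟨ psum-raise d s′ ms′ i ⟩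
      psum d i                                 ∎))
      where open ≡-Reasoning

    -- a path of the interval is the raise of d by the marks of s at which it is ahead of d
    raise-ahead : ∀ {R} (r : In R) → ∀ i → psum (descents R) i + bit (marked s i ∧ ahead (descents R) i) ≡ psum d i
    raise-ahead {R} r i with marked s i in mᵢ | ahead (descents R) i in aᵢ
    ... | false | _      = trans (ℕ.+-identityʳ _) (ℕ.≤-antisym (proj₁ (≼-in r) i) (begin
      psum d i                      ≡⟨ psum-raise d s ms i ⟨
      psum top i + bit (marked s i) ≡⟨ cong (λ b → psum top i + bit b) mᵢ ⟩
      psum top i + 0                ≡⟨ ℕ.+-identityʳ _ ⟩
      psum top i                    ≤⟨ proj₂ (≼-in r) i ⟩
      psum (descents R) i           ∎))
      where open ℕ.≤-Reasoning
    ... | true  | true  = ℕ.≤-antisym (subst (_≤ psum d i) (ℕ.+-comm 1 _) (does-true⇒ (_ ℕ.<? _) aᵢ)) (begin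
      psum d i                      ≡⟨ psum-raise d s ms i ⟨
      psum top i + bit (marked s i) ≡⟨ cong (λ b → psum top i + bit b) mᵢ ⟩
      psum top i + 1                ≤⟨ ℕ.+-monoˡ-≤ 1 (proj₂ (≼-in r) i) ⟩
      psum (descents R) i + 1       ∎)
      where open ℕ.≤-Reasoning
    ... | true  | false = trans (ℕ.+-identityʳ _) (ℕ.≤-antisym (proj₁ (≼-in r) i) (ℕ.≮⇒≥ (does-false⇒ (_ ℕ.<? _) aᵢ)))

    descents-in : ∀ {R} (r : In R) → descents R ≡ raise d (restrict s (ahead (descents R)))
    descents-in {R} r = psum-injective _ _
      (trans (Valid.length≡ (valid-of r)) (sym (trans (length-raise d _) (Valid.length≡ vd))))
      (λ i → ℕ.+-cancelʳ-≡ (bit (marked s i ∧ ahead (descents R) i)) _ _ (begin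
        psum (descents R) i + bit (marked s i ∧ ahead (descents R) i)      ≡⟨ raise-ahead r i ⟩
        psum d i                                                            ≡⟨ psum-raise d s′ ms′ i ⟨
        psum (raise d s′) i + bit (marked s′ i)                             ≡⟨ cong (λ b → psum (raise d s′) i + bit b)
                                                                                    (marked-restrict s _ i) ⟩
        psum (raise d s′) i + bit (marked s i ∧ ahead (descents R) i)      ∎))
      where
      open ≡-Reasoning
      s′ : List Bool
      s′ = restrict s (ahead (descents R))
      ms′ : Moves₀ d s′
      ms′ = Moves-⊆ d ms (restrict-⊆ s _)

    f : (R : List Step) → In R → Subset (#marks s)
    f R _ = collect s (ahead (descents R))

    g : Subset (#marks s) → List Step
    g T = path (raise d (spread s T))

    g-in : ∀ T → In (g T)
    g-in T = Valid⇒F vT , valid-≼⇒≤S vd vT (raise-above d _ mT) , valid-≼⇒≤S vT vtop (raise-mono d ms (spread-⊆ s T))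
      where
      mT : Moves₀ d (spread s T)
      mT = Moves-⊆ d ms (spread-⊆ s T)
      vT : Valid p n (raise d (spread s T))
      vT = raise-valid vd mT

    g∘f : ∀ R (r : In R) → g (f R r) ≡ R
    g∘f R r = begin
      path (raise d (spread s (collect s (ahead (descents R)))))  ≡⟨ cong (λ s′ → path (raise d s′)) (spread-collect s _) ⟩
      path (raise d (restrict s (ahead (descents R))))            ≡⟨ cong path (descents-in r) ⟨
      path (descents R)                                           ≡⟨ path-of r ⟨
      R                                                           ∎
      where open ≡-Reasoning

    f∘g : ∀ T → f (g T) (g-in T) ≡ T
    f∘g T = trans (collect-cong s (λ i → trans (cong (λ r → ahead r i) (descents-path (raise d (spread s T))))
                                              (ahead-raise (spread s T) (Moves-⊆ d ms (spread-⊆ s T)) i)))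
                  (collect-spread s T)

    f-order : ∀ R R′ (r : In R) (r′ : In R′) → (R ≤S R′) ⇔ (f R r ⊆ f R′ r′)
    f-order R R′ r r′ = mk⇔ to from
      where
      open ℕ.≤-Reasoning
      collect-⊆ : f R r ⊆ f R′ r′ ⇔ (∀ i → marked s i ≡ true → ahead (descents R) i ≡ true → ahead (descents R′) i ≡ true)
      collect-⊆ = collect-⊆⇔ s (ahead (descents R)) (ahead (descents R′))
      to : R ≤S R′ → f R r ⊆ f R′ r′
      to R≤R′ = Equivalence.from collect-⊆ λ i _ aᵢ →
        dec-true (psum (descents R′) i ℕ.<? psum d i) (ℕ.≤-<-trans (r≼r′ i) (does-true⇒ (psum (descents R) i ℕ.<? psum d i) aᵢ))
        where
        r≼r′ : descents R ≼ descents R′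
        r≼r′ = valid-≤S⇒≼ (valid-of r) (valid-of r′) (subst₂ _≤S_ (path-of r) (path-of r′) R≤R′)
      implies : ∀ {m a a′} → (m ≡ true → a ≡ true → a′ ≡ true) → m ∧ a ≡ true → m ∧ a′ ≡ true
      implies {true} {true} h _ = h refl refl
      from : f R r ⊆ f R′ r′ → R ≤S R′
      from sub = subst₂ _≤S_ (sym (path-of r)) (sym (path-of r′)) (valid-≼⇒≤S (valid-of r) (valid-of r′) λ i →
        ℕ.+-cancelʳ-≤ (bit (marked s i ∧ ahead (descents R) i)) _ _ (begin
          psum (descents R′) i + bit (marked s i ∧ ahead (descents R) i)
            ≤⟨ ℕ.+-monoʳ-≤ _ (bit-mono (implies (Equivalence.to collect-⊆ sub i))) ⟩
          psum (descents R′) i + bit (marked s i ∧ ahead (descents R′) i)  ≡⟨ raise-ahead r′ i ⟩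
          psum d i                                                          ≡⟨ raise-ahead r i ⟨
          psum (descents R) i + bit (marked s i ∧ ahead (descents R) i)    ∎))

    isBoolean : IsBoolean p n (path d) (path top)
    isBoolean = #marks s , f , g , g-in , g∘f , f∘g , f-order

  sound : ∀ {n d s} → Valid p n d → Moves₀ d s → BoolInterval p n (#marks s) (path d , path (raise d s))
  sound {n} {d} {s} vd ms =
    Valid⇒F vd , Valid⇒F vtop , d≤top , isBoolean ,
    IsomorphicInterval.maxChain {n = n} (Valid⇒F vd) (Valid⇒F vtop) d≤top f g g-in g∘f f∘g f-order
    where
    open Raised vd ms
    d≤top : path d ≤S path (raise d s)
    d≤top = valid-≼⇒≤S vd vtop (raise-above _ _ ms)

module TailCounts (q : ℕ) where

  open PowerSeries
  open import Data.Nat as ℕ using (zero; suc)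
  open import Data.Integer as ℤ using (+_)
  import Data.Integer.Properties as ℤ
  import Data.Nat.Properties as ℕ
  open import Data.Bool using (Bool; true; false)
  open import Relation.Binary.PropositionalEquality using (_≡_; refl; sym; trans; cong; cong₂; module ≡-Reasoning)

  -- tails v n k counts the admissible tails of Configurations.Tail, with p = q + 2: the first block
  -- has length 1 or 2, …, p, and the valley in front of it can be flipped only if v holds and the
  -- block is shorter than p
  mutual
    tails : Bool → ℕ → ℕ → ℕ
    tails v zero    zero    = 1
    tails v zero    (suc k) = 0
    tails v (suc n) k       = tails false n k ℕ.+ tails⁺ (suc q) n k ℕ.+ flipped v n k

    flipped : Bool → ℕ → ℕ → ℕ
    flipped false n k       = 0
    flipped true  n zero    = 0
    flipped true  n (suc k) = tails false n k ℕ.+ tails⁺ q n k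

    -- tails⁺ m n k = Σ {tails true (n - j) k | 1 ≤ j ≤ m, j ≤ n}
    tails⁺ : ℕ → ℕ → ℕ → ℕ
    tails⁺ zero    n       k = 0
    tails⁺ (suc m) zero    k = 0
    tails⁺ (suc m) (suc n) k = tails true n k ℕ.+ tails⁺ m n k

  lift : (ℕ → ℕ → ℕ) → Series
  lift c n k = + c n k

  T₀ T₁ : Series
  T₀ = lift (tails false)
  T₁ = lift (tails true)

  lift-tails⁺ : ∀ m → lift (tails⁺ m) ≈ geom m T₁
  lift-tails⁺ zero    n       k = refl
  lift-tails⁺ (suc m) zero    k = refl
  lift-tails⁺ (suc m) (suc n) k = trans (ℤ.pos-+ (tails true n k) _) (cong (λ z → T₁ n k ℤ.+ z) (lift-tails⁺ m n k))

  lift-+₃ : ∀ a b c → + (a ℕ.+ b ℕ.+ c) ≡ + a ℤ.+ + b ℤ.+ + c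
  lift-+₃ a b c = trans (ℤ.pos-+ (a ℕ.+ b) c) (cong (ℤ._+ + c) (ℤ.pos-+ a b))

  T₀-eq : T₀ ≈ δ ⊕ X T₀ ⊕ X (geom (suc q) T₁)
  T₀-eq zero    zero    = refl
  T₀-eq zero    (suc k) = refl
  T₀-eq (suc n) k = begin
    + (tails false n k ℕ.+ tails⁺ (suc q) n k ℕ.+ 0)   ≡⟨ lift-+₃ (tails false n k) (tails⁺ (suc q) n k) 0 ⟩
    T₀ n k ℤ.+ + tails⁺ (suc q) n k ℤ.+ + 0           ≡⟨ ℤ.+-identityʳ _ ⟩
    T₀ n k ℤ.+ + tails⁺ (suc q) n k                   ≡⟨ cong₂ ℤ._+_ (sym (ℤ.+-identityˡ (T₀ n k))) (lift-tails⁺ (suc q) n k) ⟩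
    + 0 ℤ.+ T₀ n k ℤ.+ geom (suc q) T₁ n k            ∎
    where open ≡-Reasoning

  T₁-eq : T₁ ≈ T₀ ⊕ Y (X T₀) ⊕ Y (X (geom q T₁))
  T₁-eq zero    zero    = refl
  T₁-eq zero    (suc k) = refl
  T₁-eq (suc n) zero    = sym (trans (ℤ.+-identityʳ _) (ℤ.+-identityʳ _))
  T₁-eq (suc n) (suc k) = begin
    + (unflipped ℕ.+ (tails false n k ℕ.+ tails⁺ q n k))         ≡⟨ ℤ.pos-+ unflipped (tails false n k ℕ.+ tails⁺ q n k) ⟩
    + unflipped ℤ.+ + (tails false n k ℕ.+ tails⁺ q n k)         ≡⟨ cong (λ z → + unflipped ℤ.+ z) (ℤ.pos-+ (tails false n k) (tails⁺ q n k)) ⟩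
    + unflipped ℤ.+ (T₀ n k ℤ.+ + tails⁺ q n k)                  ≡⟨ ℤ.+-assoc (+ unflipped) (T₀ n k) (+ tails⁺ q n k) ⟨
    + unflipped ℤ.+ T₀ n k ℤ.+ + tails⁺ q n k                    ≡⟨ cong₂ (λ a b → + a ℤ.+ T₀ n k ℤ.+ b) (sym (ℕ.+-identityʳ unflipped)) (lift-tails⁺ q n k) ⟩
    T₀ (suc n) (suc k) ℤ.+ T₀ n k ℤ.+ geom q T₁ n k              ∎
    where
    open ≡-Reasoning
    unflipped : ℕ
    unflipped = tails false n (suc k) ℕ.+ tails⁺ (suc q) n (suc k)

  ε : ℕ → ℕ → ℕ
  ε zero    zero    = 1
  ε zero    (suc k) = 0
  ε (suc n) k       = 0

  -- the number of boolean intervals of 𝔽ₙᵖ of height k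
  intervals : ℕ → ℕ → ℕ
  intervals n k = ε n k ℕ.+ tails⁺ (suc (suc q)) n k

  intervals-eq : lift intervals ≈ δ ⊕ geom (suc (suc q)) T₁
  intervals-eq n k = trans (ℤ.pos-+ (ε n k) _) (cong₂ ℤ._+_ (lift-ε n k) (lift-tails⁺ (suc (suc q)) n k))
    where
    lift-ε : ∀ n k → + ε n k ≡ δ n k
    lift-ε zero    zero    = refl
    lift-ε zero    (suc k) = refl
    lift-ε (suc n) k       = refl

module Configurations (q : ℕ) where

  open TailCounts q
  open Counting
  open DescentSequences
  open import Data.Nat as ℕ using (zero; suc; _+_; _∸_; _≤_; _<_; z≤n; s≤s)
  import Data.Nat.Properties as ℕ
  open import Data.Bool using (Bool; true; false)
  open import Data.Product using (Σ; ∃; _×_; _,_; proj₁; proj₂)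
  open import Data.Sum using (_⊎_; inj₁; inj₂)
  open import Data.Empty using (⊥; ⊥-elim)
  open import Data.Unit using (tt)
  open import Data.Product using (Σ-syntax)
  open import Data.List using (List; []; _∷_; _++_; length; replicate)
  open import Data.List.Properties using (length-++; length-replicate; ∷-injectiveʳ; ++-cancelˡ)
  open import Data.List.Relation.Unary.All using (All; []; _∷_)
  open import Data.Nat.ListAction using (sum)
  open import Relation.Binary.PropositionalEquality
    using (_≡_; refl; sym; trans; cong; subst)

  p : ℕ
  p = suc (suc q)

  open ValleyFlips p

  Marked : Set
  Marked = List ℕ × List Bool

  cons : ℕ → Bool → Marked → Marked
  cons c b (cs , bs) = c ∷ cs , b ∷ bs

  -- admissible tails: positive blocks of length ≤ p summing to n, with k flipped valleys
  Tail : Bool → ℕ → ℕ → Marked → Set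
  Tail v n k ([]     , [])     = n ≡ 0 × k ≡ 0
  Tail v n k ([]     , _ ∷ _)  = ⊥
  Tail v n k (_ ∷ _  , [])     = ⊥
  Tail v n k (c ∷ cs , b ∷ bs) = 1 ≤ c × c ≤ p × (b ≡ true → v ≡ true × suc c ≤ p) × c ≤ n × bit b ≤ k ×
                                 Tail (flippableAfter false c) (n ∸ c) (k ∸ bit b) (cs , bs)

  Headed : ℕ → Bool → (Marked → Set) → Marked → Set
  Headed c b P x = ∃ λ y → P y × x ≡ cons c b y

  -- a first block of length o + c with 1 ≤ c ≤ m, followed by a tail
  Ranged : ℕ → ℕ → Bool → ℕ → ℕ → Marked → Set
  Ranged o m b n k x = Σ ℕ λ c → 1 ≤ c × c ≤ m × c ≤ n × Headed (o + c) b (Tail true (n ∸ c) k) x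

  Flipped : Bool → ℕ → ℕ → Marked → Set
  Flipped false n k       x = ⊥
  Flipped true  n zero    x = ⊥
  Flipped true  n (suc k) x = Headed 1 true (Tail false n k) x ⊎ Ranged 1 q true n k x

  blockOf : Marked → ℕ
  blockOf (c ∷ _ , _) = c
  blockOf ([]    , _) = 0

  markOf : Marked → Bool
  markOf (_ , b ∷ _) = b
  markOf (_ , [])    = false

  Headed-head : ∀ {c b P x} → Headed c b P x → blockOf x ≡ c × markOf x ≡ b
  Headed-head (_ , _ , refl) = refl , refl

  Ranged-head : ∀ {o m b n k x} → Ranged o m b n k x → o < blockOf x × markOf x ≡ b
  Ranged-head {o} (c , 1≤c , _ , _ , _ , _ , refl) = subst (_≤ o + c) (ℕ.+-comm o 1) (ℕ.+-monoʳ-≤ o 1≤c) , refl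

  Headed-count : ∀ c b {P : Marked → Set} {N} → HasCount P N → HasCount (Headed c b P) N
  Headed-count c b count = HasCount-image count (cons c b) (λ _ _ → cons-injective _ _)
    where
    cons-injective : ∀ x y → cons c b x ≡ cons c b y → x ≡ y
    cons-injective (cs , bs) (cs′ , bs′) refl = refl

  Tail-zero : ∀ v k x → Tail v 0 k x → k ≡ 0 × x ≡ ([] , [])
  Tail-zero v k ([] , []) (_ , k≡0) = k≡0 , refl
  Tail-zero v k (c ∷ cs , b ∷ bs) (1≤c , _ , _ , c≤0 , _) with ℕ.≤-trans 1≤c c≤0
  ... | ()

  Ranged-suc : ∀ o m b n k x → Ranged o (suc m) b (suc n) k x →
               Headed (o + 1) b (Tail true n k) x ⊎ Ranged (suc o) m b n k x
  Ranged-suc o m b n k x (suc zero    , _ , _          , _          , y , tail , refl) = inj₁ (y , tail , refl)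
  Ranged-suc o m b n k x (suc (suc c) , _ , s≤s c<m , s≤s c<n , y , tail , refl) =
    inj₂ (suc c , s≤s z≤n , c<m , c<n , y , tail , cong (λ c′ → cons c′ b y) (ℕ.+-suc o (suc c)))

  Ranged-suc⁻ : ∀ o m b n k x → Headed (o + 1) b (Tail true n k) x ⊎ Ranged (suc o) m b n k x →
                Ranged o (suc m) b (suc n) k x
  Ranged-suc⁻ o m b n k x (inj₁ (y , tail , refl)) = 1 , s≤s z≤n , s≤s z≤n , s≤s z≤n , y , tail , refl
  Ranged-suc⁻ o m b n k x (inj₂ (c , 1≤c , c≤m , c≤n , y , tail , refl)) =
    suc c , s≤s z≤n , s≤s c≤m , s≤s c≤n , y , tail , cong (λ c′ → cons c′ b y) (sym (ℕ.+-suc o c))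

  Ranged-empty : ∀ o m b n k x → (m ≡ 0 ⊎ n ≡ 0) → Ranged o m b n k x → ⊥
  Ranged-empty o m b n k x (inj₁ refl) (c , 1≤c , c≤0 , _) = ℕ.<-irrefl refl (ℕ.≤-trans 1≤c c≤0)
  Ranged-empty o m b n k x (inj₂ refl) (c , 1≤c , _ , c≤0 , _) = ℕ.<-irrefl refl (ℕ.≤-trans 1≤c c≤0)

  Tail-suc : ∀ v n k x → Tail v (suc n) k x →
             (Headed 1 false (Tail false n k) x ⊎ Ranged 1 (suc q) false n k x) ⊎ Flipped v n k x
  Tail-suc v n k ([] , []) (() , _)
  Tail-suc v n k (suc zero ∷ cs , false ∷ bs) (_ , _ , _ , _ , _ , tail) = inj₁ (inj₁ ((cs , bs) , tail , refl))
  Tail-suc v n k (suc (suc c) ∷ cs , false ∷ bs) (_ , c<p , _ , c<n , _ , tail) =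
    inj₁ (inj₂ (suc c , s≤s z≤n , ℕ.≤-pred c<p , ℕ.≤-pred c<n , (cs , bs) , tail , refl))
  Tail-suc v n zero (suc c ∷ cs , true ∷ bs) (_ , _ , _ , _ , () , _)
  Tail-suc v n (suc k) (suc zero ∷ cs , true ∷ bs) (_ , _ , ok , _ , _ , tail) with proj₁ (ok refl)
  ... | refl = inj₂ (inj₁ ((cs , bs) , tail , refl))
  Tail-suc v n (suc k) (suc (suc c) ∷ cs , true ∷ bs) (_ , _ , ok , c<n , _ , tail) with ok refl
  ... | refl , s≤s (s≤s c<q) = inj₂ (inj₂ (suc c , s≤s z≤n , c<q , ℕ.≤-pred c<n , (cs , bs) , tail , refl))

  Tail-suc⁻ : ∀ v n k x → (Headed 1 false (Tail false n k) x ⊎ Ranged 1 (suc q) false n k x) ⊎ Flipped v n k x →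
              Tail v (suc n) k x
  Tail-suc⁻ v n k x (inj₁ (inj₁ (y , tail , refl))) = s≤s z≤n , s≤s z≤n , (λ ()) , s≤s z≤n , z≤n , tail
  Tail-suc⁻ v n k x (inj₁ (inj₂ (suc c , _ , c≤q , c≤n , y , tail , refl))) =
    s≤s z≤n , s≤s c≤q , (λ ()) , s≤s c≤n , z≤n , tail
  Tail-suc⁻ true n (suc k) x (inj₂ (inj₁ (y , tail , refl))) =
    s≤s z≤n , s≤s z≤n , (λ _ → refl , s≤s (s≤s z≤n)) , s≤s z≤n , s≤s z≤n , tail
  Tail-suc⁻ true n (suc k) x (inj₂ (inj₂ (suc c , _ , c<q , c≤n , y , tail , refl))) =
    s≤s z≤n , s≤s (ℕ.m≤n⇒m≤1+n c<q) , (λ _ → refl , s≤s (s≤s c<q)) , s≤s c≤n , s≤s z≤n , tail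

  Headed-Ranged-disjoint : ∀ {o b b′ P m n k} x → Headed (o + 1) b P x → Ranged (suc o) m b′ n k x → ⊥
  Headed-Ranged-disjoint {o} x h r =
    ℕ.<-irrefl (trans (ℕ.+-comm 1 o) (sym (proj₁ (Headed-head h)))) (proj₁ (Ranged-head r))

  private
    unflipped-mark : ∀ {n k} x → Headed 1 false (Tail false n k) x ⊎ Ranged 1 (suc q) false n k x → markOf x ≡ false
    unflipped-mark x (inj₁ h) = proj₂ (Headed-head h)
    unflipped-mark x (inj₂ r) = proj₂ (Ranged-head r)

    flipped-mark : ∀ {v n k} x → Flipped v n k x → markOf x ≡ true
    flipped-mark {true} {k = suc k} x (inj₁ h) = proj₂ (Headed-head h)
    flipped-mark {true} {k = suc k} x (inj₂ r) = proj₂ (Ranged-head r)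

  mutual
    tails-count : ∀ v n k → HasCount (Tail v n k) (tails v n k)
    tails-count v zero zero = HasCount-⇔ (HasCount-≡ ([] , []))
      (λ { _ refl → refl , refl })
      (λ x tail → proj₂ (Tail-zero v 0 x tail))
    tails-count v zero (suc k) = HasCount-⇔ HasCount-⊥ (λ _ ()) (λ x tail → case (proj₁ (Tail-zero v (suc k) x tail)))
      where case : suc k ≡ 0 → ⊥
            case ()
    tails-count v (suc n) k = HasCount-⇔
      (HasCount-⊎ (HasCount-⊎ (Headed-count 1 false (tails-count false n k)) (tails⁺-count 1 (suc q) false n k)
                              Headed-Ranged-disjoint)
                  (flipped-count v n k)
                  (λ x u f → case (trans (sym (unflipped-mark x u)) (flipped-mark x f))))
      (Tail-suc⁻ v n k) (Tail-suc v n k)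
      where case : false ≡ true → ⊥
            case ()

    flipped-count : ∀ v n k → HasCount (Flipped v n k) (flipped v n k)
    flipped-count false n k       = HasCount-⊥
    flipped-count true  n zero    = HasCount-⊥
    flipped-count true  n (suc k) =
      HasCount-⊎ (Headed-count 1 true (tails-count false n k)) (tails⁺-count 1 q true n k) Headed-Ranged-disjoint

    tails⁺-count : ∀ o m b n k → HasCount (Ranged o m b n k) (tails⁺ m n k)
    tails⁺-count o zero    b n       k = HasCount-⇔ HasCount-⊥ (λ _ ()) (λ x → Ranged-empty o 0 b n k x (inj₁ refl))
    tails⁺-count o (suc m) b zero    k = HasCount-⇔ HasCount-⊥ (λ _ ()) (λ x → Ranged-empty o (suc m) b 0 k x (inj₂ refl))
    tails⁺-count o (suc m) b (suc n) k = HasCount-⇔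
      (HasCount-⊎ (Headed-count (o + 1) b (tails-count true n k)) (tails⁺-count (suc o) m b n k) Headed-Ranged-disjoint)
      (Ranged-suc⁻ o m b n k) (Ranged-suc o m b n k)

  Tail⇒Moves : ∀ v n k cs bs → Tail v n k (cs , bs) →
    Positive cs × All (_≤ p) cs × sum cs ≡ n × #marks bs ≡ k × Moves false v cs bs
  Tail⇒Moves v n k []       []       (refl , refl) = [] , [] , refl , refl , tt
  Tail⇒Moves v n k (zero ∷ cs)  (b ∷ bs) (() , _)
  Tail⇒Moves v n k (suc c ∷ cs) (b ∷ bs) (1≤c , c≤p , ok , c≤n , b≤k , tail)
    with Tail⇒Moves _ _ _ cs bs tail
  ... | pos , bounded , sum≡ , #marks≡ , ms =
    1≤c ∷ pos , c≤p ∷ bounded , trans (cong (suc c +_) sum≡) (ℕ.m+[n∸m]≡n c≤n) ,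
    trans (cong (bit b +_) #marks≡) (ℕ.m+[n∸m]≡n b≤k) , ok , ms

  Moves⇒Tail : ∀ v n k cs bs → Positive cs → All (_≤ p) cs → sum cs ≡ n → #marks bs ≡ k → Moves false v cs bs →
    Tail v n k (cs , bs)
  Moves⇒Tail v n k []           []       _          _           sum≡ #marks≡ _         = sym sum≡ , sym #marks≡
  Moves⇒Tail v n k (suc c ∷ cs) (b ∷ bs) (1≤c ∷ pos) (c≤p ∷ bd) sum≡ #marks≡ (ok , ms) =
    1≤c , c≤p , ok , subst (suc c ≤_) sum≡ (ℕ.m≤m+n (suc c) (sum cs)) , subst (bit b ≤_) #marks≡ (ℕ.m≤m+n (bit b) (#marks bs)) ,
    Moves⇒Tail _ _ _ cs bs pos bd (sym (trans (cong (_∸ suc c) (sym sum≡)) (ℕ.m+n∸m≡n (suc c) (sum cs))))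
               (sym (trans (cong (_∸ bit b) (sym #marks≡)) (ℕ.m+n∸m≡n (bit b) (#marks bs)))) ms

  Config : ℕ → ℕ → Marked → Set
  Config n k (d , s) = Valid p n d × Moves₀ d s × #marks s ≡ k

  -- a configuration starts with empty, unmarked blocks, then an unmarked block followed by a tail
  zeros : ℕ → Marked → Marked
  zeros a (cs , bs) = replicate a 0 ++ cs , replicate a false ++ bs

  padded : ℕ → Marked → Marked
  padded n x = zeros (n ∸ length (proj₁ x)) x

  dropZeros : List ℕ → List ℕ
  dropZeros (zero ∷ cs) = dropZeros cs
  dropZeros cs          = cs

  dropZeros-zeros : ∀ a c cs → dropZeros (replicate a 0 ++ suc c ∷ cs) ≡ suc c ∷ cs
  dropZeros-zeros zero    c cs = refl
  dropZeros-zeros (suc a) c cs = dropZeros-zeros a c cs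

  Empty : ℕ → ℕ → Marked → Set
  Empty n k x = n ≡ 0 × k ≡ 0 × x ≡ ([] , [])

  Empty-count : ∀ n k → HasCount (Empty n k) (ε n k)
  Empty-count zero    zero    = HasCount-⇔ (HasCount-≡ ([] , [])) (λ _ x≡ → refl , refl , x≡) (λ _ → proj₂ ∘ proj₂)
    where open import Function.Base using (_∘_)
  Empty-count zero    (suc k) = HasCount-⇔ HasCount-⊥ (λ _ ()) (λ { _ (_ , () , _) })
  Empty-count (suc n) k       = HasCount-⇔ HasCount-⊥ (λ _ ()) (λ { _ (() , _) })

  Top : ℕ → ℕ → Marked → Set
  Top n k x = Empty n k x ⊎ Ranged 0 p false n k x

  Top-count : ∀ n k → HasCount (Top n k) (intervals n k)
  Top-count n k = HasCount-⊎ (Empty-count n k) (tails⁺-count 0 p false n k) disjoint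
    where
    disjoint : ∀ x → Empty n k x → Ranged 0 p false n k x → ⊥
    disjoint x (refl , _) (c , 1≤c , _ , c≤0 , _) = ℕ.<-irrefl refl (ℕ.≤-trans 1≤c c≤0)

  private
    sum-zeros : ∀ a cs → sum (replicate a 0 ++ cs) ≡ sum cs
    sum-zeros zero    cs = refl
    sum-zeros (suc a) cs = sum-zeros a cs

    #marks-zeros : ∀ a bs → #marks (replicate a false ++ bs) ≡ #marks bs
    #marks-zeros zero    bs = refl
    #marks-zeros (suc a) bs = #marks-zeros a bs

    length-zeros : ∀ {A : Set} a (x : A) xs → length (replicate a x ++ xs) ≡ a + length xs
    length-zeros a x xs = trans (length-++ (replicate a x)) (cong (_+ length xs) (length-replicate a))

    bounded-zeros : ∀ a cs → All (_≤ p) cs → All (_≤ p) (replicate a 0 ++ cs)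
    bounded-zeros zero    cs bd = bd
    bounded-zeros (suc a) cs bd = z≤n ∷ bounded-zeros a cs bd

    bounded-dropZeros : ∀ a cs → All (_≤ p) (replicate a 0 ++ cs) → All (_≤ p) cs
    bounded-dropZeros zero    cs bd        = bd
    bounded-dropZeros (suc a) cs (_ ∷ bd) = bounded-dropZeros a cs bd

    ztp-zeros : ∀ a cs → ZerosThenPositive cs → ZerosThenPositive (replicate a 0 ++ cs)
    ztp-zeros zero    cs ztp = ztp
    ztp-zeros (suc a) cs ztp = ztp-zeros a cs ztp

    Moves-zeros : ∀ a cs bs → Moves₀ cs bs → Moves₀ (replicate a 0 ++ cs) (replicate a false ++ bs)
    Moves-zeros zero    cs bs ms = ms
    Moves-zeros (suc a) cs bs ms = (λ ()) , Moves-zeros a cs bs ms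

    Moves-first : ∀ c cs bs → Moves false true cs bs → Moves₀ (suc c ∷ cs) (false ∷ bs)
    Moves-first zero    cs bs ms = (λ ()) , ms
    Moves-first (suc c) cs bs ms = (λ ()) , ms

  padded-config : ∀ n k x → Top n k x → Config n k (padded n x)
  padded-config .0 .0 .([] , []) (inj₁ (refl , refl , refl)) = valid refl refl [] tt , tt , refl
  padded-config n k x (inj₂ (zero , () , _))
  padded-config n k x (inj₂ (suc c , 1≤c , c≤p , c≤n , (cs , bs) , tail , refl))
    with Tail⇒Moves true (n ∸ suc c) k cs bs tail
  ... | pos , bounded , sum≡ , #marks≡ , ms =
    valid length≡ sum≡′ (bounded-zeros a _ (c≤p ∷ bounded)) (ztp-zeros a (suc c ∷ cs) pos) ,
    Moves-zeros a _ _ (Moves-first c cs bs ms) ,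
    trans (#marks-zeros a (false ∷ bs)) #marks≡
    where
    a : ℕ
    a = n ∸ length (suc c ∷ cs)
    length≤ : suc (length cs) ≤ n
    length≤ = ℕ.≤-trans (s≤s (ℕ.≤-trans (length≤sum pos) (ℕ.≤-reflexive sum≡)))
                        (ℕ.≤-trans (ℕ.+-monoˡ-≤ (n ∸ suc c) 1≤c) (ℕ.≤-reflexive (ℕ.m+[n∸m]≡n c≤n)))
    length≡ : length (replicate a 0 ++ suc c ∷ cs) ≡ n
    length≡ = trans (length-zeros a 0 (suc c ∷ cs)) (ℕ.m∸n+n≡m length≤)
    sum≡′ : sum (replicate a 0 ++ suc c ∷ cs) ≡ n
    sum≡′ = trans (sum-zeros a (suc c ∷ cs)) (trans (cong (suc c +_) sum≡) (ℕ.m+[n∸m]≡n c≤n))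

  split-zeros : ∀ d s → ZerosThenPositive d → Moves₀ d s → 1 ≤ sum d →
    Σ[ a ∈ ℕ ] Σ[ c ∈ ℕ ] Σ[ cs ∈ List ℕ ] Σ[ bs ∈ List Bool ]
      (d , s) ≡ zeros a (suc c ∷ cs , false ∷ bs) × Positive cs × Moves false true cs bs
  split-zeros (zero ∷ d) (true ∷ s) _ (ok , _) _ with proj₁ (ok refl)
  ... | ()
  split-zeros (zero ∷ d) (false ∷ s) ztp (_ , ms) 1≤sum with split-zeros d s ztp ms 1≤sum
  ... | a , c , cs , bs , refl , pos , ms′ = suc a , c , cs , bs , refl , pos , ms′
  split-zeros (suc c ∷ d) (true ∷ s) _ (ok , _) _ with proj₁ (ok refl)
  ... | ()
  split-zeros (suc zero ∷ d)    (false ∷ s) pos (_ , ms) _ = 0 , 0 , d , s , refl , pos , ms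
  split-zeros (suc (suc c) ∷ d) (false ∷ s) pos (_ , ms) _ = 0 , suc c , d , s , refl , pos , ms

  config-padded : ∀ n k x → Config n k x → ∃ λ y → Top n k y × x ≡ padded n y
  config-padded zero k ([] , []) (_ , _ , refl) = ([] , []) , inj₁ (refl , refl , refl) , refl
  config-padded zero k ([] , _ ∷ _) (_ , () , _)
  config-padded zero k (_ ∷ _ , s) (valid () _ _ _ , _)
  config-padded (suc n) k (d , s) (valid length≡ sum≡ bounded ztp , ms , #marks≡)
    with split-zeros d s ztp ms (subst (1 ≤_) (sym sum≡) (s≤s z≤n))
  ... | a , c , cs , bs , refl , pos , ms′ =
    (suc c ∷ cs , false ∷ bs) ,
    inj₂ (suc c , s≤s z≤n , c≤p , c≤n , (cs , bs) ,
          Moves⇒Tail true _ k cs bs pos bounded′ sum-cs (trans (sym (#marks-zeros a (false ∷ bs))) #marks≡) ms′ , refl) ,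
    cong (λ a′ → zeros a′ (suc c ∷ cs , false ∷ bs)) a≡
    where
    bounded′ : All (_≤ p) cs
    bounded′ with bounded-dropZeros a (suc c ∷ cs) bounded
    ... | _ ∷ bd = bd
    c≤p : suc c ≤ p
    c≤p with bounded-dropZeros a (suc c ∷ cs) bounded
    ... | c≤p ∷ _ = c≤p
    sum-c : suc c + sum cs ≡ suc n
    sum-c = trans (sym (sum-zeros a (suc c ∷ cs))) sum≡
    c≤n : suc c ≤ suc n
    c≤n = subst (suc c ≤_) sum-c (ℕ.m≤m+n (suc c) (sum cs))
    sum-cs : sum cs ≡ suc n ∸ suc c
    sum-cs = sym (trans (cong (_∸ suc c) (sym sum-c)) (ℕ.m+n∸m≡n (suc c) (sum cs)))
    a≡ : a ≡ suc n ∸ length (suc c ∷ cs)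
    a≡ = sym (trans (cong (_∸ length (suc c ∷ cs)) (trans (sym length≡) (length-zeros a 0 (suc c ∷ cs))))
                    (ℕ.m+n∸n≡m a (length (suc c ∷ cs))))

  padded-injective : ∀ {n k x y} → Top n k x → Top n k y → padded n x ≡ padded n y → x ≡ y
  padded-injective (inj₁ (_ , _ , refl)) (inj₁ (_ , _ , refl)) _ = refl
  padded-injective (inj₁ (refl , _)) (inj₂ (c , 1≤c , _ , c≤0 , _)) _ = ⊥-elim (ℕ.<-irrefl refl (ℕ.≤-trans 1≤c c≤0))
  padded-injective (inj₂ (c , 1≤c , _ , c≤0 , _)) (inj₁ (refl , _)) _ = ⊥-elim (ℕ.<-irrefl refl (ℕ.≤-trans 1≤c c≤0))
  padded-injective {n} (inj₂ (suc c , _ , _ , _ , (cs , bs) , _ , refl)) (inj₂ (suc c′ , _ , _ , _ , (cs′ , bs′) , _ , refl)) eq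
    with trans (sym (dropZeros-zeros (n ∸ length (suc c ∷ cs)) c cs))
               (trans (cong (dropZeros ∘ proj₁) eq) (dropZeros-zeros (n ∸ length (suc c′ ∷ cs′)) c′ cs′))
    where open import Function.Base using (_∘_)
  ... | refl = cong (λ bs″ → suc c ∷ cs , false ∷ bs″)
                    (∷-injectiveʳ (++-cancelˡ (replicate (n ∸ length (suc c ∷ cs)) false) _ _ (cong proj₂ eq)))

  Config-count : ∀ n k → HasCount (Config n k) (intervals n k)
  Config-count n k = HasCount-⇔ (HasCount-image (Top-count n k) (padded n) padded-injective)
    (λ { _ (y , top , refl) → padded-config n k y top })
    (config-padded n k)

open import Data.Nat using (suc; z≤n; s≤s)
open import Data.Integer using (+_)
open import Data.Product using (_×_; _,_; proj₁; proj₂)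
open import Data.List using (List)
open import Relation.Binary.PropositionalEquality using (_≡_; refl; trans; cong; cong₂)
open PowerSeries
open Counting
open DescentSequences

module Intervals (q : ℕ) where

  open TailCounts q
  open Configurations q
  open ValleyFlips p
  open Soundness p using (sound)
  open Completeness p (s≤s (s≤s z≤n)) using (complete)

  intervalOf : Marked → List Step × List Step
  intervalOf (d , s) = path d , path (raise d s)

  intervalOf-injective : ∀ {n k x y} → Config n k x → Config n k y → intervalOf x ≡ intervalOf y → x ≡ y
  intervalOf-injective {x = d , s} (_ , ms , _) (_ , ms′ , _) eq with path-injective (cong proj₁ eq)
  ... | refl = cong (d ,_) (raise-injective d ms ms′ (path-injective (cong proj₂ eq)))

  BoolInterval-count : ∀ n k → HasCount (BoolInterval p n k) (intervals n k)
  BoolInterval-count n k = HasCount-⇔ (HasCount-image (Config-count n k) intervalOf intervalOf-injective)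
    (λ { _ ((d , s) , (vd , ms , refl) , refl) → sound vd ms })
    (λ { (P , Q) bi → let ((d , s) , (vd , ms , #s) , P≡ , Q≡) = complete bi in
                      (d , s) , (vd , ms , #s) , cong₂ _,_ P≡ Q≡ })

corollary2p4 : (p : ℕ) → 2 ≤ p → (b : ℕ → ℕ → ℕ) →
    (∀ n k → HasCount (BoolInterval p n k) (b n k)) →
    ∀ n k → (coeff (denom p) ⋆ (λ i j → + b i j)) n k ≡ coeff (numer p) n k
corollary2p4 (suc (suc q)) (s≤s (s≤s z≤n)) b b-counts =
  GeneratingFunction.generating-function q T₀-eq T₁-eq b-eq
  where
  open TailCounts q
  open Intervals q
  b-eq : (λ i j → + b i j) ≈ δ ⊕ geom (suc (suc q)) T₁
  b-eq n k = trans (cong +_ (HasCount-unique (b-counts n k) (BoolInterval-count n k))) (intervals-eq n k)
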